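{- Let $\nu\in\mathbb{N}_0$, let $m,n>0$ and $r=m-n$. Then \[\sum_{\mu=0}^\nu\binom{\nu-\frac12}{\nu-\mu}\binom{\nu+\frac12}{\mu}\left(m^{ -\nu-\frac12}P_{2\nu+2,\frac32-\mu}(r,n)-n^{\mu-\frac12}m^{\nu-\mu}\right)=-2^{ -2\nu}\binom{2\nu}{\nu}(mn)^{ -\frac12}\left(m^{\frac12}-n^{\frac12}\right)^{2\nu+1}.\]
   Context: For an integer $a\ge2$ and $b\in\mathbb{C}$, $P_{a,b}(X,Y):=\sum_{j=0}^{a-2}\binom{j+b-2}{j}X^j(X+Y)^{a-j-2}$; binomial coefficients with non-integer upper entry are generalized: $\binom{x}{j}=x(x-1)\cdots(x-j+1)/j!$. -}

module Defs where

open import Level using (Level)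
open import Data.Nat as ℕ using (ℕ; zero; suc; _∸_)
open import Data.Nat.Combinatorics using (_C_)
open import Data.Integer using (+_)
open import Data.Rational as ℚ using (ℚ; _/_; ½)
open import Algebra.Bundles using (CommutativeRing; Semiring)
import Algebra.Definitions.RawSemiring as RawSemiringDefs

ℕ→ℚ : ℕ → ℚ
ℕ→ℚ k = (+ k) / 1

binom : ℚ → ℕ → ℚ
binom x zero    = ℚ.1ℚ
binom x (suc j) = binom x j ℚ.* (x ℚ.- ℕ→ℚ j) ℚ.* ((+ 1) / suc j)

-- Everything below lives in a commutative ring R equipped with a map
-- ι : ℚ → R (assumed, in the statement, to be a ring homomorphism,
-- i.e. R is a ℚ-algebra; e.g. R = ℝ).
module InRing {c ℓ : Level} (R : CommutativeRing c ℓ) (ι : ℚ → CommutativeRing.Carrier R) where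
  open CommutativeRing R
  open RawSemiringDefs (Semiring.rawSemiring semiring) using (_^_) public

  Σ≤ : ℕ → (ℕ → Carrier) → Carrier
  Σ≤ zero    f = f 0
  Σ≤ (suc k) f = Σ≤ k f + f (suc k)

  -- P_{a,b}(X,Y) = Σ_{j=0}^{a-2} binom(j+b-2, j) X^j (X+Y)^{a-j-2}   (used with a ≥ 2)
  P : ℕ → ℚ → Carrier → Carrier → Carrier
  P a b X Y = Σ≤ (a ∸ 2) λ j →
    ι (binom (ℕ→ℚ j ℚ.+ b ℚ.- ℕ→ℚ 2) j) * (X ^ j) * ((X + Y) ^ (a ∸ 2 ∸ j))

  -- s = m^{1/2}, t = n^{1/2}, s⁻ = s^{-1}, t⁻ = t^{-1};  m = s², n = t², r = m - n.
  module _ (s t s⁻ t⁻ : Carrier) where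
    m n r : Carrier
    m = s * s
    n = t * t
    r = m - n

    LHS : ℕ → Carrier
    LHS ν = Σ≤ ν λ μ →
      ι (binom (ℕ→ℚ ν ℚ.- ½) (ν ∸ μ)) * ι (binom (ℕ→ℚ ν ℚ.+ ½) μ) *
      ( (s⁻ ^ (2 ℕ.* ν ℕ.+ 1)) * P (2 ℕ.* ν ℕ.+ 2) ((+ 3) / 2 ℚ.- ℕ→ℚ μ) r n
        -  ((t ^ (2 ℕ.* μ)) * t⁻) * (m ^ (ν ∸ μ)) )
        -- m^{-ν-1/2} = s⁻^{2ν+1},  n^{μ-1/2} = t^{2μ} t⁻

    RHS : ℕ → Carrier
    RHS ν = - ( (ι ½ ^ (2 ℕ.* ν)) * ι (ℕ→ℚ ((2 ℕ.* ν) C ν)) * (s⁻ * t⁻) * ((s - t) ^ (2 ℕ.* ν ℕ.+ 1)) )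

-- Write m = s², n = t², r = m - n and N = 2ν+1.  The half-integral binomial weights become
-- integral: binom(ν-½, ν-μ)·binom(ν+½, μ) = binom(ν-½, ν)·C(N, 2μ) and binom(ν-½, ν) = 4^{-ν}·C(2ν, ν),
-- since in each case both sides satisfy the same first-order recurrence with the same initial value.
-- Expanding P with r + n = m, the coefficient of r^j m^{2ν-j} in Σ_μ C(N,2μ)·P_{2ν+2,3/2-μ}(r,n) is
-- Σ_μ C(N,2μ)·binom(j-½-μ, j).  This is the even half of Σ_i (-1)^i C(N,i)·binom(j-½-i/2, j), which
-- vanishes because the summand is a polynomial of degree j < N in i; by upper negation the odd half is
-- -(-1)^j Σ_k C(N,2k+1)·binom(k, j).  Resumming over j with the binomial theorem gives
-- Σ_μ C(N,2μ)·P_{2ν+2,3/2-μ}(r,n) = Σ_k C(N,2k+1)·m^{2ν-k}·n^k.  Multiplied by the unit s^N·t, the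
-- μ-sum of the brackets therefore becomes s^{2ν}·(O - E), where (s - t)^N = E - O is the binomial
-- expansion split into even and odd powers of t.

module Submission where

open import Defs
open import Data.Nat using (ℕ)
open import Data.Rational using (ℚ)
open import Data.Rational.Properties using (+-*-ring)
open import Algebra.Bundles using (CommutativeRing; Ring)
open import Algebra.Morphism.Structures using (IsRingHomomorphism)
open import Level using (Level)
open import Data.Maybe using (Maybe; just; nothing)
import Data.Nat as ℕ
import Data.Nat.Properties as ℕ
import Data.Integer as ℤ
import Data.Rational as ℚ
import Data.Rational.Properties as ℚ
open import Relation.Binary.PropositionalEquality as ≡ using (_≡_)

-- Σ≤ is only available inside Defs.InRing, hence the (unused) parameter ι.
module FiniteSums {c ℓ : Level} (R : CommutativeRing c ℓ) (ι : ℚ → CommutativeRing.Carrier R) where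
  open import Data.Nat using (zero; suc; _≤_; _<_; z≤n; s≤s)
  import Tactic.RingSolver.Core.AlmostCommutativeRing as ACR
  open CommutativeRing R
  open InRing R ι using (Σ≤)
  open import Relation.Binary.Reasoning.Setoid setoid
  open import Tactic.RingSolver.NonReflective (ACR.fromCommutativeRing R (λ _ → nothing))
    using (solve; _⊜_; _⊕_; ⊝_)

  Σ≤-cong≤ : ∀ k {f g : ℕ → Carrier} → (∀ i → i ≤ k → f i ≈ g i) → Σ≤ k f ≈ Σ≤ k g
  Σ≤-cong≤ zero    f≈g = f≈g 0 z≤n
  Σ≤-cong≤ (suc k) f≈g =
    +-cong (Σ≤-cong≤ k (λ i i≤k → f≈g i (ℕ.m≤n⇒m≤1+n i≤k))) (f≈g (suc k) ℕ.≤-refl)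

  Σ≤-cong : ∀ k {f g : ℕ → Carrier} → (∀ i → f i ≈ g i) → Σ≤ k f ≈ Σ≤ k g
  Σ≤-cong k f≈g = Σ≤-cong≤ k (λ i _ → f≈g i)

  Σ≤-distrib-+ : ∀ k (f g : ℕ → Carrier) → Σ≤ k (λ i → f i + g i) ≈ Σ≤ k f + Σ≤ k g
  Σ≤-distrib-+ zero    f g = refl
  Σ≤-distrib-+ (suc k) f g = trans (+-congʳ (Σ≤-distrib-+ k f g))
    (solve 4 (λ a b x y → ((a ⊕ b) ⊕ (x ⊕ y)) ⊜ ((a ⊕ x) ⊕ (b ⊕ y))) refl _ _ _ _)

  Σ≤-neg : ∀ k (f : ℕ → Carrier) → - Σ≤ k f ≈ Σ≤ k (λ i → - f i)
  Σ≤-neg zero    f = refl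
  Σ≤-neg (suc k) f = trans (solve 2 (λ a b → (⊝ (a ⊕ b)) ⊜ (⊝ a ⊕ ⊝ b)) refl _ _) (+-congʳ (Σ≤-neg k f))

  Σ≤-distrib-sub : ∀ k (f g : ℕ → Carrier) → Σ≤ k (λ i → f i - g i) ≈ Σ≤ k f - Σ≤ k g
  Σ≤-distrib-sub k f g = trans (Σ≤-distrib-+ k f (λ i → - g i)) (+-congˡ (sym (Σ≤-neg k g)))

  *-distribˡ-Σ≤ : ∀ k a (f : ℕ → Carrier) → a * Σ≤ k f ≈ Σ≤ k (λ i → a * f i)
  *-distribˡ-Σ≤ zero    a f = refl
  *-distribˡ-Σ≤ (suc k) a f = trans (distribˡ a _ _) (+-congʳ (*-distribˡ-Σ≤ k a f))

  *-distribʳ-Σ≤ : ∀ k a (f : ℕ → Carrier) → Σ≤ k f * a ≈ Σ≤ k (λ i → f i * a)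
  *-distribʳ-Σ≤ zero    a f = refl
  *-distribʳ-Σ≤ (suc k) a f = trans (distribʳ a _ _) (+-congʳ (*-distribʳ-Σ≤ k a f))

  Σ≤-comm : ∀ a b (f : ℕ → ℕ → Carrier) →
    Σ≤ a (λ i → Σ≤ b (f i)) ≈ Σ≤ b (λ j → Σ≤ a (λ i → f i j))
  Σ≤-comm zero    b f = refl
  Σ≤-comm (suc a) b f = trans (+-congʳ (Σ≤-comm a b f)) (sym (Σ≤-distrib-+ b _ _))

  Σ≤-suc : ∀ k (f : ℕ → Carrier) → Σ≤ (suc k) f ≈ f 0 + Σ≤ k (λ i → f (suc i))
  Σ≤-suc zero    f = refl
  Σ≤-suc (suc k) f = trans (+-congʳ (Σ≤-suc k f)) (+-assoc _ _ _)

  Σ≤-vanishing-tail : ∀ k d (f : ℕ → Carrier) → (∀ i → k < i → f i ≈ 0#) →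
    Σ≤ (k ℕ.+ d) f ≈ Σ≤ k f
  Σ≤-vanishing-tail k zero    f f≈0 = reflexive (≡.cong (λ n → Σ≤ n f) (ℕ.+-identityʳ k))
  Σ≤-vanishing-tail k (suc d) f f≈0 = begin
    Σ≤ (k ℕ.+ suc d) f             ≡⟨ ≡.cong (λ n → Σ≤ n f) (ℕ.+-suc k d) ⟩
    Σ≤ (k ℕ.+ d) f + f (suc (k ℕ.+ d)) ≈⟨ +-cong (Σ≤-vanishing-tail k d f f≈0) (f≈0 _ (s≤s (ℕ.m≤m+n k d))) ⟩
    Σ≤ k f + 0#                    ≈⟨ +-identityʳ _ ⟩
    Σ≤ k f                         ∎

  Σ≤-even-odd : ∀ ν (f : ℕ → Carrier) →
    Σ≤ (suc (2 ℕ.* ν)) f ≈ Σ≤ ν (λ μ → f (2 ℕ.* μ)) + Σ≤ ν (λ k → f (suc (2 ℕ.* k)))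
  Σ≤-even-odd zero    f = refl
  Σ≤-even-odd (suc ν) f = begin
    Σ≤ (suc (2 ℕ.* suc ν)) f
      ≡⟨ ≡.cong (λ n → Σ≤ (suc n) f) (ℕ.*-suc 2 ν) ⟩
    Σ≤ (suc (2 ℕ.* ν)) f + f (2 ℕ.+ 2 ℕ.* ν) + f (3 ℕ.+ 2 ℕ.* ν)
      ≈⟨ +-congʳ (+-congʳ (Σ≤-even-odd ν f)) ⟩
    Σ≤ ν (λ μ → f (2 ℕ.* μ)) + Σ≤ ν (λ k → f (suc (2 ℕ.* k))) + f (2 ℕ.+ 2 ℕ.* ν) + f (3 ℕ.+ 2 ℕ.* ν)
      ≈⟨ solve 4 (λ a b x y → (a ⊕ b ⊕ x ⊕ y) ⊜ ((a ⊕ x) ⊕ (b ⊕ y))) refl _ _ _ _ ⟩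
    (Σ≤ ν (λ μ → f (2 ℕ.* μ)) + f (2 ℕ.+ 2 ℕ.* ν)) + (Σ≤ ν (λ k → f (suc (2 ℕ.* k))) + f (3 ℕ.+ 2 ℕ.* ν))
      ≡⟨ ≡.cong₂ (λ p q → (Σ≤ ν (λ μ → f (2 ℕ.* μ)) + f p) + (Σ≤ ν (λ k → f (suc (2 ℕ.* k))) + f (suc q)))
           (≡.sym (ℕ.*-suc 2 ν)) (≡.sym (ℕ.*-suc 2 ν)) ⟩
    Σ≤ (suc ν) (λ μ → f (2 ℕ.* μ)) + Σ≤ (suc ν) (λ k → f (suc (2 ℕ.* k))) ∎


module HalfIntegerBinomials where
  open import Data.Nat using (zero; suc; _∸_; _≤_; _<_; z≤n; s≤s)
  import Data.Nat.Coprimality as Coprime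
  open import Data.Nat.Combinatorics using (_C_; nCk+nC[k+1]≡[n+1]C[k+1])
  import Data.Integer.Properties as ℤₚ
  open import Data.Rational using (mkℚ; 0ℚ; 1ℚ; ½; _+_; _*_; _-_; -_; toℚᵘ)
  import Data.Rational.Unnormalised as ℚᵘ
  import Data.Rational.Unnormalised.Properties as ℚᵘ
  open import Data.Rational.Solver using (module +-*-Solver)
  open import Data.Sum using (inj₁; inj₂)
  open import Relation.Binary.PropositionalEquality
  open ≡-Reasoning
  open InRing ℚ.+-*-commutativeRing (λ q → q) using (_^_)
  open +-*-Solver

  ℕ→ℚ≡mkℚ : ∀ n → ℕ→ℚ n ≡ mkℚ (ℤ.+ n) 0 (Coprime.sym (Coprime.1-coprimeTo n))
  ℕ→ℚ≡mkℚ n = ℚ.normalize-coprime (Coprime.sym (Coprime.1-coprimeTo n))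

  ℕ→ℚ-suc : ∀ n → ℕ→ℚ (suc n) ≡ 1ℚ + ℕ→ℚ n
  ℕ→ℚ-suc n = ℚ.toℚᵘ-injective (ℚᵘ.≃-trans toℚᵘ-suc (ℚᵘ.≃-sym (ℚ.toℚᵘ-homo-+ 1ℚ (ℕ→ℚ n))))
    where
    toℚᵘ-suc : toℚᵘ (ℕ→ℚ (suc n)) ℚᵘ.≃ toℚᵘ 1ℚ ℚᵘ.+ toℚᵘ (ℕ→ℚ n)
    toℚᵘ-suc rewrite ℕ→ℚ≡mkℚ (suc n) | ℕ→ℚ≡mkℚ n | ℕ.*-identityʳ n | ℤₚ.+◃n≡+n n = ℚᵘ.*≡* refl

  ℕ→ℚ-+ : ∀ a b → ℕ→ℚ (a ℕ.+ b) ≡ ℕ→ℚ a + ℕ→ℚ b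
  ℕ→ℚ-+ zero    b = sym (ℚ.+-identityˡ _)
  ℕ→ℚ-+ (suc a) b = begin
    ℕ→ℚ (suc (a ℕ.+ b))          ≡⟨ ℕ→ℚ-suc (a ℕ.+ b) ⟩
    1ℚ + ℕ→ℚ (a ℕ.+ b)           ≡⟨ cong (1ℚ +_) (ℕ→ℚ-+ a b) ⟩
    1ℚ + (ℕ→ℚ a + ℕ→ℚ b)         ≡⟨ ℚ.+-assoc 1ℚ (ℕ→ℚ a) (ℕ→ℚ b) ⟨
    1ℚ + ℕ→ℚ a + ℕ→ℚ b           ≡⟨ cong (_+ ℕ→ℚ b) (ℕ→ℚ-suc a) ⟨
    ℕ→ℚ (suc a) + ℕ→ℚ b          ∎

  ℕ→ℚ-double : ∀ a → ℕ→ℚ (2 ℕ.* a) ≡ ℕ→ℚ a + ℕ→ℚ a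
  ℕ→ℚ-double a = trans (cong ℕ→ℚ (cong (a ℕ.+_) (ℕ.+-identityʳ a))) (ℕ→ℚ-+ a a)

  1/[1+_] : ℕ → ℚ
  1/[1+ k ] = (ℤ.+ 1) ℚ./ suc k

  1/[1+k]*[1+k]≡1 : ∀ k → 1/[1+ k ] * (1ℚ + ℕ→ℚ k) ≡ 1ℚ
  1/[1+k]*[1+k]≡1 k = begin
    1/[1+ k ] * (1ℚ + ℕ→ℚ k)
      ≡⟨ cong (1/[1+ k ] *_) (ℕ→ℚ-suc k) ⟨
    1/[1+ k ] * ℕ→ℚ (suc k)
      ≡⟨ ℚ.toℚᵘ-injective (ℚᵘ.≃-trans (ℚ.toℚᵘ-homo-* 1/[1+ k ] (ℕ→ℚ (suc k))) product) ⟩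
    1ℚ ∎
    where
    product : toℚᵘ 1/[1+ k ] ℚᵘ.* toℚᵘ (ℕ→ℚ (suc k)) ℚᵘ.≃ toℚᵘ 1ℚ
    product rewrite ℚ.normalize-coprime (Coprime.1-coprimeTo (suc k)) | ℕ→ℚ≡mkℚ (suc k) =
      ℚᵘ.*≡* (trans (ℤₚ.*-identityʳ _) (sym (trans (ℤₚ.*-identityˡ _)
        (cong (λ n → ℤ.+ suc n) (trans (ℕ.*-identityʳ k) (sym (ℕ.+-identityʳ k)))))))

  p*1/[1+k]*[1+k]≡p : ∀ k p → p * 1/[1+ k ] * (1ℚ + ℕ→ℚ k) ≡ p
  p*1/[1+k]*[1+k]≡p k p = begin
    p * 1/[1+ k ] * (1ℚ + ℕ→ℚ k)   ≡⟨ ℚ.*-assoc p _ _ ⟩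
    p * (1/[1+ k ] * (1ℚ + ℕ→ℚ k)) ≡⟨ cong (p *_) (1/[1+k]*[1+k]≡1 k) ⟩
    p * 1ℚ                         ≡⟨ ℚ.*-identityʳ p ⟩
    p                              ∎

  Cancellableʳ : ℚ → Set
  Cancellableʳ c = ∀ {p q} → p * c ≡ q * c → p ≡ q

  *-cancelʳ-1+ℕ→ℚ : ∀ k → Cancellableʳ (1ℚ + ℕ→ℚ k)
  *-cancelʳ-1+ℕ→ℚ k {p} {q} eq = begin
    p                              ≡⟨ undo p ⟨
    p * (1ℚ + ℕ→ℚ k) * 1/[1+ k ]   ≡⟨ cong (_* 1/[1+ k ]) eq ⟩
    q * (1ℚ + ℕ→ℚ k) * 1/[1+ k ]   ≡⟨ undo q ⟩
    q                              ∎
    where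
    undo : ∀ p → p * (1ℚ + ℕ→ℚ k) * 1/[1+ k ] ≡ p
    undo p = trans (solve 3 (λ p n i → p :* n :* i := p :* i :* n) refl p _ _) (p*1/[1+k]*[1+k]≡p k p)

  binom-suc : ∀ x j → binom x (suc j) * (1ℚ + ℕ→ℚ j) ≡ binom x j * (x - ℕ→ℚ j)
  binom-suc x j = p*1/[1+k]*[1+k]≡p j (binom x j * (x - ℕ→ℚ j))

  binom-pascal : ∀ x j → binom (1ℚ + x) (suc j) ≡ binom x (suc j) + binom x j
  binom-pascal x zero = solve 1 (λ x →
    con 1ℚ :* (con 1ℚ :+ x :- con 0ℚ) :* con 1ℚ := con 1ℚ :* (x :- con 0ℚ) :* con 1ℚ :+ con 1ℚ) refl x
  binom-pascal x (suc j) = *-cancelʳ-1+ℕ→ℚ (suc j) (begin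
    binom (1ℚ + x) (2 ℕ.+ j) * (1ℚ + n₁)
      ≡⟨ binom-suc (1ℚ + x) (suc j) ⟩
    binom (1ℚ + x) (suc j) * (1ℚ + x - n₁)
      ≡⟨ cong₂ (λ b n → b * (1ℚ + x - n)) (binom-pascal x j) (ℕ→ℚ-suc j) ⟩
    (b₁ + b₀) * (1ℚ + x - (1ℚ + jq))
      ≡⟨ solve 4 (λ b₁ b₀ x j →
                                                    (b₁ :+ b₀) :* (con 1ℚ :+ x :- (con 1ℚ :+ j)) :=
                                                    b₁ :* (x :- j) :+ b₀ :* (x :- j)) refl b₁ b₀ x jq ⟩
    b₁ * (x - jq) + b₀ * (x - jq)
      ≡⟨ cong (b₁ * (x - jq) +_) (binom-suc x j) ⟨
    b₁ * (x - jq) + b₁ * (1ℚ + jq)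
      ≡⟨ solve 3 (λ b₁ x j →
                                                    b₁ :* (x :- j) :+ b₁ :* (con 1ℚ :+ j) := b₁ :* (con 1ℚ :+ x)) refl b₁ x jq ⟩
    b₁ * (1ℚ + x)
      ≡⟨ solve 3 (λ b₁ x n →
                                                    b₁ :* (x :- n) :+ b₁ :* (con 1ℚ :+ n) := b₁ :* (con 1ℚ :+ x)) refl b₁ x n₁ ⟨
    b₁ * (x - n₁) + b₁ * (1ℚ + n₁)
      ≡⟨ cong (_+ b₁ * (1ℚ + n₁)) (binom-suc x (suc j)) ⟨
    binom x (2 ℕ.+ j) * (1ℚ + n₁) + b₁ * (1ℚ + n₁)
      ≡⟨ ℚ.*-distribʳ-+ (1ℚ + n₁) (binom x (2 ℕ.+ j)) b₁ ⟨
    (binom x (2 ℕ.+ j) + b₁) * (1ℚ + n₁) ∎)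
    where
    b₀ b₁ jq n₁ : ℚ
    b₀ = binom x j
    b₁ = binom x (suc j)
    jq = ℕ→ℚ j
    n₁ = ℕ→ℚ (suc j)

  binom-absorb : ∀ x j → binom (1ℚ + x) (suc j) * (1ℚ + ℕ→ℚ j) ≡ (1ℚ + x) * binom x j
  binom-absorb x j = begin
    binom (1ℚ + x) (suc j) * (1ℚ + jq)             ≡⟨ cong (_* (1ℚ + jq)) (binom-pascal x j) ⟩
    (binom x (suc j) + binom x j) * (1ℚ + jq)      ≡⟨ ℚ.*-distribʳ-+ (1ℚ + jq) (binom x (suc j)) (binom x j) ⟩
    binom x (suc j) * (1ℚ + jq) + binom x j * (1ℚ + jq) ≡⟨ cong (_+ binom x j * (1ℚ + jq)) (binom-suc x j) ⟩
    binom x j * (x - jq) + binom x j * (1ℚ + jq)   ≡⟨ solve 3 (λ b x j →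
                                                       b :* (x :- j) :+ b :* (con 1ℚ :+ j) := (con 1ℚ :+ x) :* b) refl (binom x j) x jq ⟩
    (1ℚ + x) * binom x j                           ∎
    where
    jq : ℚ
    jq = ℕ→ℚ j

  sign : ℕ → ℚ
  sign zero    = 1ℚ
  sign (suc j) = - sign j

  sign-even : ∀ μ → sign (2 ℕ.* μ) ≡ 1ℚ
  sign-even zero    = refl
  sign-even (suc μ) = begin
    sign (2 ℕ.* suc μ)        ≡⟨ cong sign (ℕ.*-suc 2 μ) ⟩
    - - sign (2 ℕ.* μ)        ≡⟨ solve 1 (λ s → :- :- s := s) refl (sign (2 ℕ.* μ)) ⟩
    sign (2 ℕ.* μ)            ≡⟨ sign-even μ ⟩
    1ℚ                        ∎

  binom-negate-upper : ∀ y j → binom (ℕ→ℚ j - 1ℚ - y) j ≡ sign j * binom y j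
  binom-negate-upper y zero    = sym (ℚ.*-identityˡ 1ℚ)
  binom-negate-upper y (suc j) = *-cancelʳ-1+ℕ→ℚ j (begin
    binom (ℕ→ℚ (suc j) - 1ℚ - y) (suc j) * (1ℚ + jq)  ≡⟨ cong (λ z → binom z (suc j) * (1ℚ + jq)) upper ⟩
    binom (1ℚ + z) (suc j) * (1ℚ + jq)                 ≡⟨ binom-absorb z j ⟩
    (1ℚ + z) * binom z j                               ≡⟨ cong ((1ℚ + z) *_) (binom-negate-upper y j) ⟩
    (1ℚ + z) * (sign j * binom y j)                    ≡⟨ solve 4 (λ j y s b →
                                                            (con 1ℚ :+ (j :- con 1ℚ :- y)) :* (s :* b) :=
                                                            :- s :* (b :* (y :- j))) refl jq y (sign j) (binom y j) ⟩
    - sign j * (binom y j * (y - jq))                  ≡⟨ cong (- sign j *_) (binom-suc y j) ⟨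
    - sign j * (binom y (suc j) * (1ℚ + jq))           ≡⟨ ℚ.*-assoc (- sign j) _ _ ⟨
    - sign j * binom y (suc j) * (1ℚ + jq)             ∎)
    where
    jq z : ℚ
    jq = ℕ→ℚ j
    z  = jq - 1ℚ - y
    upper : ℕ→ℚ (suc j) - 1ℚ - y ≡ 1ℚ + z
    upper = trans (cong (λ n → n - 1ℚ - y) (ℕ→ℚ-suc j))
      (solve 2 (λ j y → con 1ℚ :+ j :- con 1ℚ :- y := con 1ℚ :+ (j :- con 1ℚ :- y)) refl jq y)

  binom-ℕ-vanish : ∀ {n k} → n < k → binom (ℕ→ℚ n) k ≡ 0ℚ
  binom-ℕ-vanish {n} {suc k} (s≤s n≤k) with ℕ.m≤n⇒m<n∨m≡n n≤k
  ... | inj₁ n<k = begin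
    binom (ℕ→ℚ n) k * (ℕ→ℚ n - ℕ→ℚ k) * 1/[1+ k ]
      ≡⟨ cong (λ b → b * (ℕ→ℚ n - ℕ→ℚ k) * 1/[1+ k ]) (binom-ℕ-vanish n<k) ⟩
    0ℚ * (ℕ→ℚ n - ℕ→ℚ k) * 1/[1+ k ]
      ≡⟨ solve 2 (λ a i → con 0ℚ :* a :* i := con 0ℚ) refl (ℕ→ℚ n - ℕ→ℚ k) 1/[1+ k ] ⟩
    0ℚ ∎
  ... | inj₂ refl = solve 3 (λ b n i → b :* (n :- n) :* i := con 0ℚ) refl (binom (ℕ→ℚ n) n) (ℕ→ℚ n) 1/[1+ n ]

  ℕ→ℚ-C : ∀ n k → ℕ→ℚ (n C k) ≡ binom (ℕ→ℚ n) k
  ℕ→ℚ-C n       zero    = refl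
  ℕ→ℚ-C zero    (suc k) = sym (binom-ℕ-vanish {k = suc k} (s≤s z≤n))
  ℕ→ℚ-C (suc n) (suc k) = begin
    ℕ→ℚ (suc n C suc k)                         ≡⟨ cong ℕ→ℚ (nCk+nC[k+1]≡[n+1]C[k+1] n k) ⟨
    ℕ→ℚ (n C k ℕ.+ n C suc k)                   ≡⟨ ℕ→ℚ-+ (n C k) (n C suc k) ⟩
    ℕ→ℚ (n C k) + ℕ→ℚ (n C suc k)               ≡⟨ cong₂ _+_ (ℕ→ℚ-C n k) (ℕ→ℚ-C n (suc k)) ⟩
    binom (ℕ→ℚ n) k + binom (ℕ→ℚ n) (suc k)     ≡⟨ ℚ.+-comm (binom (ℕ→ℚ n) k) _ ⟩
    binom (ℕ→ℚ n) (suc k) + binom (ℕ→ℚ n) k     ≡⟨ binom-pascal (ℕ→ℚ n) k ⟨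
    binom (1ℚ + ℕ→ℚ n) (suc k)                  ≡⟨ cong (λ x → binom x (suc k)) (ℕ→ℚ-suc n) ⟨
    binom (ℕ→ℚ (suc n)) (suc k)                 ∎

  Cancellableʳ-* : ∀ {a b} → Cancellableʳ a → Cancellableʳ b → Cancellableʳ (a * b)
  Cancellableʳ-* {a} {b} cancel-a cancel-b {p} {q} eq =
    cancel-a (cancel-b (trans (ℚ.*-assoc p a b) (trans eq (sym (ℚ.*-assoc q a b)))))

  SolvesRecurrence : ℕ → (w ρ f : ℕ → ℚ) → Set
  SolvesRecurrence n w ρ f = ∀ μ → μ < n → f (suc μ) * w μ ≡ f μ * ρ μ

  recurrence-unique : ∀ {n w ρ} f g → (∀ μ → Cancellableʳ (w μ)) → f 0 ≡ g 0 →
    SolvesRecurrence n w ρ f → SolvesRecurrence n w ρ g → ∀ μ → μ ≤ n → f μ ≡ g μ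
  recurrence-unique f g cancel f0≡g0 rec-f rec-g zero    _     = f0≡g0
  recurrence-unique {w = w} {ρ} f g cancel f0≡g0 rec-f rec-g (suc μ) μ<n = cancel μ (begin
    f (suc μ) * w μ  ≡⟨ rec-f μ μ<n ⟩
    f μ * ρ μ        ≡⟨ cong (_* ρ μ) (recurrence-unique f g cancel f0≡g0 rec-f rec-g μ (ℕ.<⇒≤ μ<n)) ⟩
    g μ * ρ μ        ≡⟨ rec-g μ μ<n ⟨
    g (suc μ) * w μ  ∎)

  binom-central-suc : ∀ μ → let x = ℕ→ℚ (2 ℕ.* μ) in
    binom (ℕ→ℚ (2 ℕ.* suc μ)) (suc μ) * (1ℚ + ℕ→ℚ μ) * (1ℚ + ℕ→ℚ μ) ≡ (1ℚ + (1ℚ + x)) * (1ℚ + x) * binom x μ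
  binom-central-suc μ = begin
    binom (ℕ→ℚ (2 ℕ.* suc μ)) (suc μ) * (1ℚ + μq) * (1ℚ + μq)
      ≡⟨ cong (λ y → binom y (suc μ) * (1ℚ + μq) * (1ℚ + μq)) 2+x ⟩
    binom (1ℚ + (1ℚ + x)) (suc μ) * (1ℚ + μq) * (1ℚ + μq)
      ≡⟨ cong (_* (1ℚ + μq)) (binom-absorb (1ℚ + x) μ) ⟩
    (1ℚ + (1ℚ + x)) * binom (1ℚ + x) μ * (1ℚ + μq)
      ≡⟨ ℚ.*-assoc (1ℚ + (1ℚ + x)) _ _ ⟩
    (1ℚ + (1ℚ + x)) * (binom (1ℚ + x) μ * (1ℚ + μq))
      ≡⟨ cong (λ y → (1ℚ + (1ℚ + x)) * (binom (1ℚ + x) μ * y)) 1+x-μ ⟨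
    (1ℚ + (1ℚ + x)) * (binom (1ℚ + x) μ * (1ℚ + x - μq))
      ≡⟨ cong ((1ℚ + (1ℚ + x)) *_) (binom-suc (1ℚ + x) μ) ⟨
    (1ℚ + (1ℚ + x)) * (binom (1ℚ + x) (suc μ) * (1ℚ + μq))
      ≡⟨ cong ((1ℚ + (1ℚ + x)) *_) (binom-absorb x μ) ⟩
    (1ℚ + (1ℚ + x)) * ((1ℚ + x) * binom x μ)
      ≡⟨ ℚ.*-assoc (1ℚ + (1ℚ + x)) _ _ ⟨
    (1ℚ + (1ℚ + x)) * (1ℚ + x) * binom x μ ∎
    where
    μq x : ℚ
    μq = ℕ→ℚ μ
    x  = ℕ→ℚ (2 ℕ.* μ)
    2+x : ℕ→ℚ (2 ℕ.* suc μ) ≡ 1ℚ + (1ℚ + x)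
    2+x = trans (cong ℕ→ℚ (ℕ.*-suc 2 μ)) (trans (ℕ→ℚ-suc (suc (2 ℕ.* μ))) (cong (1ℚ +_) (ℕ→ℚ-suc (2 ℕ.* μ))))
    1+x-μ : 1ℚ + x - μq ≡ 1ℚ + μq
    1+x-μ = trans (cong (λ y → 1ℚ + y - μq) (ℕ→ℚ-double μ)) (solve 1 (λ m → con 1ℚ :+ (m :+ m) :- m := con 1ℚ :+ m) refl μq)

  binom-central : ∀ ν → binom (ℕ→ℚ ν - ½) ν ≡ ½ ^ (2 ℕ.* ν) * binom (ℕ→ℚ (2 ℕ.* ν)) ν
  binom-central ν = recurrence-unique f g (λ μ → Cancellableʳ-* (*-cancelʳ-1+ℕ→ℚ μ) (*-cancelʳ-1+ℕ→ℚ μ))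
    refl rec-f rec-g ν ℕ.≤-refl
    where
    f g w ρ : ℕ → ℚ
    f μ = binom (ℕ→ℚ μ - ½) μ
    g μ = ½ ^ (2 ℕ.* μ) * binom (ℕ→ℚ (2 ℕ.* μ)) μ
    w μ = (1ℚ + ℕ→ℚ μ) * (1ℚ + ℕ→ℚ μ)
    ρ μ = (ℕ→ℚ μ + ½) * (1ℚ + ℕ→ℚ μ)

    rec-f : SolvesRecurrence ν w ρ f
    rec-f μ _ = begin
      binom (ℕ→ℚ (suc μ) - ½) (suc μ) * ((1ℚ + μq) * (1ℚ + μq))
        ≡⟨ cong (λ x → binom x (suc μ) * ((1ℚ + μq) * (1ℚ + μq))) upper ⟩
      binom (1ℚ + (μq - ½)) (suc μ) * ((1ℚ + μq) * (1ℚ + μq))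
        ≡⟨ ℚ.*-assoc (binom (1ℚ + (μq - ½)) (suc μ)) _ _ ⟨
      binom (1ℚ + (μq - ½)) (suc μ) * (1ℚ + μq) * (1ℚ + μq)
        ≡⟨ cong (_* (1ℚ + μq)) (binom-absorb (μq - ½) μ) ⟩
      (1ℚ + (μq - ½)) * f μ * (1ℚ + μq)
        ≡⟨ solve 2 (λ m b → (con 1ℚ :+ (m :- con ½)) :* b :* (con 1ℚ :+ m) :=
                            b :* ((m :+ con ½) :* (con 1ℚ :+ m))) refl μq (f μ) ⟩
      f μ * ρ μ ∎
      where
      μq : ℚ
      μq = ℕ→ℚ μ
      upper : ℕ→ℚ (suc μ) - ½ ≡ 1ℚ + (μq - ½)
      upper = trans (cong (_- ½) (ℕ→ℚ-suc μ)) (ℚ.+-assoc 1ℚ μq (- ½))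

    rec-g : SolvesRecurrence ν w ρ g
    rec-g μ _ = begin
      ½ ^ (2 ℕ.* suc μ) * c * ((1ℚ + μq) * (1ℚ + μq))
        ≡⟨ cong (λ k → ½ ^ k * c * ((1ℚ + μq) * (1ℚ + μq))) (ℕ.*-suc 2 μ) ⟩
      ½ * (½ * h) * c * ((1ℚ + μq) * (1ℚ + μq))
        ≡⟨ solve 3 (λ h c m → con ½ :* (con ½ :* h) :* c :* ((con 1ℚ :+ m) :* (con 1ℚ :+ m)) :=
                              con ½ :* (con ½ :* h) :* (c :* (con 1ℚ :+ m) :* (con 1ℚ :+ m))) refl h c μq ⟩
      ½ * (½ * h) * (c * (1ℚ + μq) * (1ℚ + μq))
        ≡⟨ cong (½ * (½ * h) *_) (binom-central-suc μ) ⟩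
      ½ * (½ * h) * ((1ℚ + (1ℚ + x)) * (1ℚ + x) * binom x μ)
        ≡⟨ cong (λ y → ½ * (½ * h) * ((1ℚ + (1ℚ + y)) * (1ℚ + y) * binom x μ)) (ℕ→ℚ-double μ) ⟩
      ½ * (½ * h) * ((1ℚ + (1ℚ + (μq + μq))) * (1ℚ + (μq + μq)) * binom x μ)
        ≡⟨ solve 3 (λ h b m → con ½ :* (con ½ :* h) :* ((con 1ℚ :+ (con 1ℚ :+ (m :+ m))) :* (con 1ℚ :+ (m :+ m)) :* b) :=
                              h :* b :* ((m :+ con ½) :* (con 1ℚ :+ m))) refl h (binom x μ) μq ⟩
      g μ * ρ μ ∎
      where
      μq x h c : ℚ
      μq = ℕ→ℚ μ
      x  = ℕ→ℚ (2 ℕ.* μ)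
      h  = ½ ^ (2 ℕ.* μ)
      c  = binom (ℕ→ℚ (2 ℕ.* suc μ)) (suc μ)

  ℕ→ℚ-suc-double : ∀ a → ℕ→ℚ (suc (2 ℕ.* a)) ≡ 1ℚ + (ℕ→ℚ a + ℕ→ℚ a)
  ℕ→ℚ-suc-double a = trans (ℕ→ℚ-suc (2 ℕ.* a)) (cong (1ℚ +_) (ℕ→ℚ-double a))

  binom-suc-suc : ∀ x j → binom x (2 ℕ.+ j) * ((1ℚ + ℕ→ℚ (suc j)) * (1ℚ + ℕ→ℚ j))
                        ≡ binom x j * ((x - ℕ→ℚ (suc j)) * (x - ℕ→ℚ j))
  binom-suc-suc x j = begin
    binom x (2 ℕ.+ j) * ((1ℚ + ℕ→ℚ (suc j)) * (1ℚ + ℕ→ℚ j))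
      ≡⟨ ℚ.*-assoc (binom x (2 ℕ.+ j)) _ _ ⟨
    binom x (2 ℕ.+ j) * (1ℚ + ℕ→ℚ (suc j)) * (1ℚ + ℕ→ℚ j)
      ≡⟨ cong (_* (1ℚ + ℕ→ℚ j)) (binom-suc x (suc j)) ⟩
    binom x (suc j) * (x - ℕ→ℚ (suc j)) * (1ℚ + ℕ→ℚ j)
      ≡⟨ solve 3 (λ b u v → b :* u :* v := b :* v :* u) refl (binom x (suc j)) _ _ ⟩
    binom x (suc j) * (1ℚ + ℕ→ℚ j) * (x - ℕ→ℚ (suc j))
      ≡⟨ cong (_* (x - ℕ→ℚ (suc j))) (binom-suc x j) ⟩
    binom x j * (x - ℕ→ℚ j) * (x - ℕ→ℚ (suc j))
      ≡⟨ solve 3 (λ b u v → b :* u :* v := b :* (v :* u)) refl (binom x j) _ _ ⟩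
    binom x j * ((x - ℕ→ℚ (suc j)) * (x - ℕ→ℚ j)) ∎

  ∸≡suc∸suc : ∀ {m n} → m < n → n ∸ m ≡ suc (n ∸ suc m)
  ∸≡suc∸suc {zero}  {suc n} _         = refl
  ∸≡suc∸suc {suc m} {suc n} (s≤s m<n) = ∸≡suc∸suc m<n

  binom-half-product : ∀ ν μ → μ ≤ ν →
    binom (ℕ→ℚ ν - ½) (ν ∸ μ) * binom (ℕ→ℚ ν + ½) μ ≡
    binom (ℕ→ℚ ν - ½) ν * binom (ℕ→ℚ (suc (2 ℕ.* ν))) (2 ℕ.* μ)
  binom-half-product ν = recurrence-unique f g
    (λ μ → Cancellableʳ-* (*-cancelʳ-1+ℕ→ℚ (suc (2 ℕ.* μ))) (*-cancelʳ-1+ℕ→ℚ (2 ℕ.* μ))) refl rec-f rec-g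
    where
    νq Nq : ℚ
    νq = ℕ→ℚ ν
    Nq = ℕ→ℚ (suc (2 ℕ.* ν))
    f g w ρ : ℕ → ℚ
    f μ = binom (νq - ½) (ν ∸ μ) * binom (νq + ½) μ
    g μ = binom (νq - ½) ν * binom Nq (2 ℕ.* μ)
    w μ = (1ℚ + ℕ→ℚ (suc (2 ℕ.* μ))) * (1ℚ + ℕ→ℚ (2 ℕ.* μ))
    ρ μ = (Nq - ℕ→ℚ (suc (2 ℕ.* μ))) * (Nq - ℕ→ℚ (2 ℕ.* μ))

    rec-g : SolvesRecurrence ν w ρ g
    rec-g μ _ = begin
      c * binom Nq (2 ℕ.* suc μ) * w μ        ≡⟨ cong (λ k → c * binom Nq k * w μ) (ℕ.*-suc 2 μ) ⟩
      c * binom Nq (2 ℕ.+ 2 ℕ.* μ) * w μ      ≡⟨ ℚ.*-assoc c _ _ ⟩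
      c * (binom Nq (2 ℕ.+ 2 ℕ.* μ) * w μ)    ≡⟨ cong (c *_) (binom-suc-suc Nq (2 ℕ.* μ)) ⟩
      c * (binom Nq (2 ℕ.* μ) * ρ μ)          ≡⟨ ℚ.*-assoc c _ _ ⟨
      c * binom Nq (2 ℕ.* μ) * ρ μ            ∎
      where
      c : ℚ
      c = binom (νq - ½) ν

    rec-f : SolvesRecurrence ν w ρ f
    rec-f μ μ<ν = begin
      a′ * b′ * w μ
        ≡⟨ cong (a′ * b′ *_) (cong₂ (λ u v → (1ℚ + u) * (1ℚ + v)) (ℕ→ℚ-suc-double μ) (ℕ→ℚ-double μ)) ⟩
      a′ * b′ * ((1ℚ + (1ℚ + (μq + μq))) * (1ℚ + (μq + μq)))
        ≡⟨ solve 3 (λ a′ b′ m → a′ :* b′ :* ((con 1ℚ :+ (con 1ℚ :+ (m :+ m))) :* (con 1ℚ :+ (m :+ m))) :=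
                                con (ℕ→ℚ 4) :* (a′ :* (m :+ con ½)) :* (b′ :* (con 1ℚ :+ m))) refl a′ b′ μq ⟩
      ℕ→ℚ 4 * (a′ * (μq + ½)) * (b′ * (1ℚ + μq))
        ≡⟨ cong₂ (λ u v → ℕ→ℚ 4 * u * v) lower-step upper-step ⟩
      ℕ→ℚ 4 * (a * (1ℚ + kq)) * (b * (kq + (ℤ.+ 3) ℚ./ 2))
        ≡⟨ solve 4 (λ a b m k → con (ℕ→ℚ 4) :* (a :* (con 1ℚ :+ k)) :* (b :* (k :+ con ((ℤ.+ 3) ℚ./ 2))) :=
                                a :* b :* ((con 1ℚ :+ ((con 1ℚ :+ m :+ k) :+ (con 1ℚ :+ m :+ k)) :- (con 1ℚ :+ (m :+ m))) :*
                                           (con 1ℚ :+ ((con 1ℚ :+ m :+ k) :+ (con 1ℚ :+ m :+ k)) :- (m :+ m))))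
             refl a b μq kq ⟩
      a * b * ρ′ (1ℚ + μq + kq)
        ≡⟨ cong (λ v → a * b * ρ′ v) ν≡1+μ+k ⟨
      a * b * ρ′ νq
        ≡⟨ cong (a * b *_) ρ-expand ⟨
      a * b * ρ μ
        ≡⟨ cong (λ i → binom (νq - ½) i * b * ρ μ) (∸≡suc∸suc μ<ν) ⟨
      f μ * ρ μ ∎
      where
      k : ℕ
      k  = ν ∸ suc μ
      μq kq a a′ b b′ : ℚ
      μq = ℕ→ℚ μ
      kq = ℕ→ℚ k
      a  = binom (νq - ½) (suc k)
      a′ = binom (νq - ½) k
      b  = binom (νq + ½) μ
      b′ = binom (νq + ½) (suc μ)
      ν≡1+μ+k : νq ≡ 1ℚ + μq + kq
      ν≡1+μ+k = trans (cong ℕ→ℚ (sym (ℕ.m+[n∸m]≡n μ<ν))) (trans (ℕ→ℚ-+ (suc μ) k) (cong (_+ kq) (ℕ→ℚ-suc μ)))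
      lower-step : a′ * (μq + ½) ≡ a * (1ℚ + kq)
      lower-step = sym (trans (binom-suc (νq - ½) k) (trans (cong (λ v → a′ * (v - ½ - kq)) ν≡1+μ+k)
        (cong (a′ *_) (solve 2 (λ m k → con 1ℚ :+ m :+ k :- con ½ :- k := m :+ con ½) refl μq kq))))
      upper-step : b′ * (1ℚ + μq) ≡ b * (kq + (ℤ.+ 3) ℚ./ 2)
      upper-step = trans (binom-suc (νq + ½) μ) (trans (cong (λ v → b * (v + ½ - μq)) ν≡1+μ+k)
        (cong (b *_) (solve 2 (λ m k → con 1ℚ :+ m :+ k :+ con ½ :- m := k :+ con ((ℤ.+ 3) ℚ./ 2)) refl μq kq)))
      ρ′ : ℚ → ℚ
      ρ′ v = (1ℚ + (v + v) - (1ℚ + (μq + μq))) * (1ℚ + (v + v) - (μq + μq))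
      ρ-expand : ρ μ ≡ ρ′ νq
      ρ-expand = trans (cong₂ (λ n u → (n - u) * (n - ℕ→ℚ (2 ℕ.* μ))) (ℕ→ℚ-suc-double ν) (ℕ→ℚ-suc-double μ))
                       (cong (λ u → (1ℚ + (νq + νq) - (1ℚ + (μq + μq))) * (1ℚ + (νq + νq) - u)) (ℕ→ℚ-double μ))


module FiniteDifferences where
  open import Data.Nat using (zero; suc; _∸_; _≤_)
  open import Data.Rational using (0ℚ; 1ℚ; ½; _+_; _*_; _-_; -_)
  open import Data.Rational.Solver using (module +-*-Solver)
  open import Algebra.Properties.Group ℚ.+-0-group using (x∙y⁻¹≈ε⇒x≈y)
  open import Relation.Binary.PropositionalEquality
  open ≡-Reasoning
  open InRing ℚ.+-*-commutativeRing (λ q → q) using (Σ≤)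
  open FiniteSums ℚ.+-*-commutativeRing (λ q → q)
  open HalfIntegerBinomials
  open +-*-Solver

  Δ : (ℕ → ℚ) → ℕ → ℚ
  Δ f i = f (suc i) - f i

  DegreeBelow : ℕ → (ℕ → ℚ) → Set
  DegreeBelow zero    f = ∀ i → f i ≡ 0ℚ
  DegreeBelow (suc d) f = DegreeBelow d (Δ f)

  DegreeBelow-cong : ∀ d {f g} → (∀ i → f i ≡ g i) → DegreeBelow d f → DegreeBelow d g
  DegreeBelow-cong zero    f≡g f-deg i = trans (sym (f≡g i)) (f-deg i)
  DegreeBelow-cong (suc d) f≡g f-deg = DegreeBelow-cong d (λ i → cong₂ _-_ (f≡g (suc i)) (f≡g i)) f-deg

  DegreeBelow-+ : ∀ d f g → DegreeBelow d f → DegreeBelow d g → DegreeBelow d (λ i → f i + g i)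
  DegreeBelow-+ zero    f g f-deg g-deg i = cong₂ _+_ (f-deg i) (g-deg i)
  DegreeBelow-+ (suc d) f g f-deg g-deg = DegreeBelow-cong d
    (λ i → solve 4 (λ a b c d → (a :- b) :+ (c :- d) := (a :+ c) :- (b :+ d)) refl (f (suc i)) (f i) (g (suc i)) (g i))
    (DegreeBelow-+ d (Δ f) (Δ g) f-deg g-deg)

  DegreeBelow-scale : ∀ d a f → DegreeBelow d f → DegreeBelow d (λ i → a * f i)
  DegreeBelow-scale zero    a f f-deg i = trans (cong (a *_) (f-deg i)) (ℚ.*-zeroʳ a)
  DegreeBelow-scale (suc d) a f f-deg = DegreeBelow-cong d
    (λ i → solve 3 (λ a x y → a :* (x :- y) := a :* x :- a :* y) refl a (f (suc i)) (f i))
    (DegreeBelow-scale d a (Δ f) f-deg)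

  DegreeBelow-suc : ∀ d f → DegreeBelow d f → DegreeBelow (suc d) f
  DegreeBelow-suc zero    f f-deg i = cong₂ _-_ (f-deg (suc i)) (f-deg i)
  DegreeBelow-suc (suc d) f f-deg   = DegreeBelow-suc d (Δ f) f-deg

  DegreeBelow-weaken : ∀ e d f → DegreeBelow d f → DegreeBelow (e ℕ.+ d) f
  DegreeBelow-weaken zero    d f f-deg = f-deg
  DegreeBelow-weaken (suc e) d f f-deg = DegreeBelow-suc (e ℕ.+ d) f (DegreeBelow-weaken e d f f-deg)

  DegreeBelow-*-linear : ∀ d a b f → DegreeBelow d f →
    DegreeBelow (suc d) (λ i → f i * (a * ℕ→ℚ i + b))
  DegreeBelow-*-linear zero a b f f-deg i = trans
    (cong₂ (λ u v → u * (a * ℕ→ℚ (suc i) + b) - v * (a * ℕ→ℚ i + b)) (f-deg (suc i)) (f-deg i))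
    (solve 2 (λ u v → con 0ℚ :* u :- con 0ℚ :* v := con 0ℚ) refl (a * ℕ→ℚ (suc i) + b) (a * ℕ→ℚ i + b))
  DegreeBelow-*-linear (suc d) a b f f-deg = DegreeBelow-cong (suc d) {g = Δ (λ i → f i * (a * ℕ→ℚ i + b))} product-rule
    (DegreeBelow-+ (suc d) (λ i → Δ f i * (a * ℕ→ℚ i + (a + b))) (λ i → a * f i)
      (DegreeBelow-*-linear d a (a + b) (Δ f) f-deg) (DegreeBelow-scale (suc d) a f f-deg))
    where
    product-rule : ∀ i → Δ f i * (a * ℕ→ℚ i + (a + b)) + a * f i ≡ Δ (λ i → f i * (a * ℕ→ℚ i + b)) i
    product-rule i = begin
      (f (suc i) - f i) * (a * ℕ→ℚ i + (a + b)) + a * f i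
        ≡⟨ solve 5 (λ f₁ f₀ a b n → (f₁ :- f₀) :* (a :* n :+ (a :+ b)) :+ a :* f₀ :=
                                    f₁ :* (a :* (con 1ℚ :+ n) :+ b) :- f₀ :* (a :* n :+ b)) refl (f (suc i)) (f i) a b (ℕ→ℚ i) ⟩
      f (suc i) * (a * (1ℚ + ℕ→ℚ i) + b) - f i * (a * ℕ→ℚ i + b)
        ≡⟨ cong (λ n → f (suc i) * (a * n + b) - f i * (a * ℕ→ℚ i + b)) (ℕ→ℚ-suc i) ⟨
      f (suc i) * (a * ℕ→ℚ (suc i) + b) - f i * (a * ℕ→ℚ i + b) ∎

  binom-linear-DegreeBelow : ∀ j w c → DegreeBelow (suc j) (λ i → binom (w + c * ℕ→ℚ i) j)
  binom-linear-DegreeBelow zero    w c i = ℚ.+-inverseʳ 1ℚ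
  binom-linear-DegreeBelow (suc j) w c = DegreeBelow-cong (suc (suc j)) recurrence
    (DegreeBelow-*-linear (suc j) (c * 1/[1+ j ]) ((w - ℕ→ℚ j) * 1/[1+ j ]) (λ i → binom (w + c * ℕ→ℚ i) j)
      (binom-linear-DegreeBelow j w c))
    where
    recurrence : ∀ i → binom (w + c * ℕ→ℚ i) j * (c * 1/[1+ j ] * ℕ→ℚ i + (w - ℕ→ℚ j) * 1/[1+ j ])
                     ≡ binom (w + c * ℕ→ℚ i) (suc j)
    recurrence i = solve 6 (λ b c u n w k → b :* (c :* u :* n :+ (w :- k) :* u) := b :* (w :+ c :* n :- k) :* u)
      refl (binom (w + c * ℕ→ℚ i) j) c 1/[1+ j ] (ℕ→ℚ i) w (ℕ→ℚ j)

  alternating-sum : ℕ → (ℕ → ℚ) → ℚ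
  alternating-sum N f = Σ≤ N (λ i → sign i * binom (ℕ→ℚ N) i * f i)

  alternating-sum-suc : ∀ N f → alternating-sum (suc N) f ≡ alternating-sum N f - alternating-sum N (λ i → f (suc i))
  alternating-sum-suc N f = begin
    alternating-sum (suc N) f
      ≡⟨ Σ≤-suc N _ ⟩
    t 0 + Σ≤ N (λ i → - sign i * binom (ℕ→ℚ (suc N)) (suc i) * f (suc i))
      ≡⟨ cong (t 0 +_) (trans (Σ≤-cong N pascal-split) (Σ≤-distrib-sub N (λ i → t (suc i)) s)) ⟩
    t 0 + (Σ≤ N (λ i → t (suc i)) - Σ≤ N s)
      ≡⟨ ℚ.+-assoc (t 0) _ _ ⟨
    t 0 + Σ≤ N (λ i → t (suc i)) - Σ≤ N s
      ≡⟨ cong (_- Σ≤ N s) (Σ≤-suc N t) ⟨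
    Σ≤ N t + t (suc N) - Σ≤ N s
      ≡⟨ cong (λ x → Σ≤ N t + x - Σ≤ N s) t-top ⟩
    Σ≤ N t + 0ℚ - Σ≤ N s
      ≡⟨ cong (_- Σ≤ N s) (ℚ.+-identityʳ (Σ≤ N t)) ⟩
    Σ≤ N t - Σ≤ N s ∎
    where
    t s : ℕ → ℚ
    t i = sign i * binom (ℕ→ℚ N) i * f i
    s i = sign i * binom (ℕ→ℚ N) i * f (suc i)
    pascal-split : ∀ i → - sign i * binom (ℕ→ℚ (suc N)) (suc i) * f (suc i) ≡ t (suc i) - s i
    pascal-split i = begin
      - sign i * binom (ℕ→ℚ (suc N)) (suc i) * f (suc i)
        ≡⟨ cong (λ x → - sign i * binom x (suc i) * f (suc i)) (ℕ→ℚ-suc N) ⟩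
      - sign i * binom (1ℚ + ℕ→ℚ N) (suc i) * f (suc i)
        ≡⟨ cong (λ b → - sign i * b * f (suc i)) (binom-pascal (ℕ→ℚ N) i) ⟩
      - sign i * (binom (ℕ→ℚ N) (suc i) + binom (ℕ→ℚ N) i) * f (suc i)
        ≡⟨ solve 4 (λ σ b₁ b₀ x → :- σ :* (b₁ :+ b₀) :* x := :- σ :* b₁ :* x :- σ :* b₀ :* x)
             refl (sign i) (binom (ℕ→ℚ N) (suc i)) (binom (ℕ→ℚ N) i) (f (suc i)) ⟩
      t (suc i) - s i ∎
    t-top : t (suc N) ≡ 0ℚ
    t-top = trans (cong (λ b → sign (suc N) * b * f (suc N)) (binom-ℕ-vanish (ℕ.n<1+n N)))
                  (solve 2 (λ σ x → σ :* con 0ℚ :* x := con 0ℚ) refl (sign (suc N)) (f (suc N)))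

  alternating-sum-Δ : ∀ N f → alternating-sum N f - alternating-sum N (λ i → f (suc i)) ≡ - alternating-sum N (Δ f)
  alternating-sum-Δ N f = begin
    alternating-sum N f - alternating-sum N (λ i → f (suc i))
      ≡⟨ Σ≤-distrib-sub N _ _ ⟨
    Σ≤ N (λ i → c i * f i - c i * f (suc i))
      ≡⟨ Σ≤-cong N (λ i → solve 3 (λ c x y → c :* y :- c :* x := :- (c :* (x :- y))) refl (c i) (f (suc i)) (f i)) ⟩
    Σ≤ N (λ i → - (c i * Δ f i))
      ≡⟨ Σ≤-neg N _ ⟨
    - alternating-sum N (Δ f) ∎
    where
    c : ℕ → ℚ
    c i = sign i * binom (ℕ→ℚ N) i

  alternating-sum-DegreeBelow : ∀ N f → DegreeBelow N f → alternating-sum N f ≡ 0ℚ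
  alternating-sum-DegreeBelow zero    f f-deg = cong (1ℚ * 1ℚ *_) (f-deg 0)
  alternating-sum-DegreeBelow (suc N) f f-deg = begin
    alternating-sum (suc N) f
      ≡⟨ alternating-sum-suc N f ⟩
    alternating-sum N f - alternating-sum N (λ i → f (suc i))
      ≡⟨ alternating-sum-Δ N f ⟩
    - alternating-sum N (Δ f)
      ≡⟨ cong -_ (alternating-sum-DegreeBelow N (Δ f) f-deg) ⟩
    - 0ℚ
      ≡⟨⟩
    0ℚ ∎

  even-odd-moments : ∀ ν j → j ≤ 2 ℕ.* ν →
    Σ≤ ν (λ μ → binom (ℕ→ℚ (suc (2 ℕ.* ν))) (2 ℕ.* μ) * binom (ℕ→ℚ j + ((ℤ.+ 3) ℚ./ 2 - ℕ→ℚ μ) - ℕ→ℚ 2) j) ≡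
    sign j * Σ≤ ν (λ k → binom (ℕ→ℚ (suc (2 ℕ.* ν))) (suc (2 ℕ.* k)) * binom (ℕ→ℚ k) j)
  even-odd-moments ν j j≤2ν = x∙y⁻¹≈ε⇒x≈y _ _ (begin
    Σ≤ ν (λ μ → C (2 ℕ.* μ) * β μ) - sign j * Σ≤ ν (λ k → C (suc (2 ℕ.* k)) * binom (ℕ→ℚ k) j)
      ≡⟨ cong₂ _-_ (sym (Σ≤-cong ν even)) (*-distribˡ-Σ≤ ν (sign j) _) ⟩
    Σ≤ ν (λ μ → g (2 ℕ.* μ)) - Σ≤ ν (λ k → sign j * (C (suc (2 ℕ.* k)) * binom (ℕ→ℚ k) j))
      ≡⟨ cong (Σ≤ ν (λ μ → g (2 ℕ.* μ)) +_) (trans (Σ≤-neg ν _) (Σ≤-cong ν odd)) ⟩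
    Σ≤ ν (λ μ → g (2 ℕ.* μ)) + Σ≤ ν (λ k → g (suc (2 ℕ.* k)))
      ≡⟨ Σ≤-even-odd ν g ⟨
    alternating-sum N h
      ≡⟨ alternating-sum-DegreeBelow N h h-degree ⟩
    0ℚ ∎)
    where
    N : ℕ
    N = suc (2 ℕ.* ν)
    C : ℕ → ℚ
    C = binom (ℕ→ℚ N)
    β : ℕ → ℚ
    β μ = binom (ℕ→ℚ j + ((ℤ.+ 3) ℚ./ 2 - ℕ→ℚ μ) - ℕ→ℚ 2) j
    h g : ℕ → ℚ
    h i = binom (ℕ→ℚ j - ½ + (- ½) * ℕ→ℚ i) j
    g i = sign i * C i * h i

    h-degree : DegreeBelow N h
    h-degree = subst (λ d → DegreeBelow d h) (trans (ℕ.+-suc (2 ℕ.* ν ∸ j) j) (cong suc (ℕ.m∸n+n≡m j≤2ν)))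
      (DegreeBelow-weaken (2 ℕ.* ν ∸ j) (suc j) h (binom-linear-DegreeBelow j (ℕ→ℚ j - ½) (- ½)))

    even : ∀ μ → g (2 ℕ.* μ) ≡ C (2 ℕ.* μ) * β μ
    even μ = begin
      sign (2 ℕ.* μ) * C (2 ℕ.* μ) * h (2 ℕ.* μ)
        ≡⟨ cong (λ σ → σ * C (2 ℕ.* μ) * h (2 ℕ.* μ)) (sign-even μ) ⟩
      1ℚ * C (2 ℕ.* μ) * h (2 ℕ.* μ)
        ≡⟨ cong (_* h (2 ℕ.* μ)) (ℚ.*-identityˡ (C (2 ℕ.* μ))) ⟩
      C (2 ℕ.* μ) * h (2 ℕ.* μ)
        ≡⟨ cong (λ x → C (2 ℕ.* μ) * binom x j) upper ⟩
      C (2 ℕ.* μ) * β μ ∎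
      where
      upper : ℕ→ℚ j - ½ + (- ½) * ℕ→ℚ (2 ℕ.* μ) ≡ ℕ→ℚ j + ((ℤ.+ 3) ℚ./ 2 - ℕ→ℚ μ) - ℕ→ℚ 2
      upper = trans (cong (λ m → ℕ→ℚ j - ½ + (- ½) * m) (ℕ→ℚ-double μ))
        (solve 2 (λ j m → j :- con ½ :+ (:- con ½) :* (m :+ m) := j :+ (con ((ℤ.+ 3) ℚ./ 2) :- m) :- con (ℕ→ℚ 2))
          refl (ℕ→ℚ j) (ℕ→ℚ μ))

    odd : ∀ k → - (sign j * (C (suc (2 ℕ.* k)) * binom (ℕ→ℚ k) j)) ≡ g (suc (2 ℕ.* k))
    odd k = begin
      - (sign j * (C (suc (2 ℕ.* k)) * binom (ℕ→ℚ k) j))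
        ≡⟨ solve 3 (λ σ c b → :- (σ :* (c :* b)) := :- con 1ℚ :* c :* (σ :* b)) refl (sign j) (C (suc (2 ℕ.* k))) _ ⟩
      - 1ℚ * C (suc (2 ℕ.* k)) * (sign j * binom (ℕ→ℚ k) j)
        ≡⟨ cong₂ (λ σ b → - σ * C (suc (2 ℕ.* k)) * b) (sign-even k) (binom-negate-upper (ℕ→ℚ k) j) ⟨
      - sign (2 ℕ.* k) * C (suc (2 ℕ.* k)) * binom (ℕ→ℚ j - 1ℚ - ℕ→ℚ k) j
        ≡⟨ cong (λ x → - sign (2 ℕ.* k) * C (suc (2 ℕ.* k)) * binom x j) upper ⟨
      g (suc (2 ℕ.* k)) ∎
      where
      upper : ℕ→ℚ j - ½ + (- ½) * ℕ→ℚ (suc (2 ℕ.* k)) ≡ ℕ→ℚ j - 1ℚ - ℕ→ℚ k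
      upper = trans (cong (λ m → ℕ→ℚ j - ½ + (- ½) * m) (ℕ→ℚ-suc-double k))
        (solve 2 (λ j m → j :- con ½ :+ (:- con ½) :* (con 1ℚ :+ (m :+ m)) := j :- con 1ℚ :- m) refl (ℕ→ℚ j) (ℕ→ℚ k))

module Exponents where
  open import Data.Nat using (suc; _∸_; _+_; _*_; _≤_)
  open import Relation.Binary.PropositionalEquality
  open ≡-Reasoning

  2*[2ν∸k]≡2ν+[2ν∸2k] : ∀ {ν k} → k ≤ ν → 2 * (2 * ν ∸ k) ≡ 2 * ν + (2 * ν ∸ 2 * k)
  2*[2ν∸k]≡2ν+[2ν∸2k] {ν} {k} k≤ν = begin
    2 * (2 * ν ∸ k)            ≡⟨ ℕ.*-distribˡ-∸ 2 (2 * ν) k ⟩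
    2 * (2 * ν) ∸ 2 * k        ≡⟨ cong (λ n → 2 * ν + n ∸ 2 * k) (ℕ.+-identityʳ (2 * ν)) ⟩
    2 * ν + 2 * ν ∸ 2 * k      ≡⟨ ℕ.+-∸-assoc (2 * ν) (ℕ.*-monoʳ-≤ 2 k≤ν) ⟩
    2 * ν + (2 * ν ∸ 2 * k)    ∎

  1+2ν+2[ν∸μ]≡2ν+[1+2ν∸2μ] : ∀ {ν μ} → μ ≤ ν → suc (2 * ν) + 2 * (ν ∸ μ) ≡ 2 * ν + (suc (2 * ν) ∸ 2 * μ)
  1+2ν+2[ν∸μ]≡2ν+[1+2ν∸2μ] {ν} {μ} μ≤ν = begin
    suc (2 * ν) + 2 * (ν ∸ μ)          ≡⟨ cong (suc (2 * ν) +_) (ℕ.*-distribˡ-∸ 2 ν μ) ⟩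
    suc (2 * ν + (2 * ν ∸ 2 * μ))      ≡⟨ ℕ.+-suc (2 * ν) _ ⟨
    2 * ν + suc (2 * ν ∸ 2 * μ)        ≡⟨ cong (2 * ν +_) (ℕ.+-∸-assoc 1 (ℕ.*-monoʳ-≤ 2 μ≤ν)) ⟨
    2 * ν + (suc (2 * ν) ∸ 2 * μ)      ∎

module InAlgebra {c ℓ : Level} (R : CommutativeRing c ℓ) (ι : ℚ → CommutativeRing.Carrier R)
  (ι-hom : IsRingHomomorphism (Ring.rawRing ℚ.+-*-ring) (CommutativeRing.rawRing R) ι) where
  open import Data.Nat using (zero; suc; _∸_; _≤_; _<_)
  open import Data.Nat.Combinatorics using (_C_)
  open import Data.Fin using (toℕ)
  import Algebra.Solver.Ring.AlmostCommutativeRing as SolverRing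
  open import Relation.Nullary using (yes; no)
  open HalfIntegerBinomials using (ℕ→ℚ-suc; ℕ→ℚ-C; binom-ℕ-vanish; sign; sign-even; binom-half-product; binom-central)
  open FiniteDifferences using (even-odd-moments)
  open Exponents
  open CommutativeRing R
  open InRing R ι hiding (m; n; r)
  open InRing ℚ.+-*-commutativeRing (λ q → q) using () renaming (Σ≤ to Σ≤ℚ; _^_ to _^ℚ_)
  open FiniteSums R ι
  open IsRingHomomorphism ι-hom
    renaming (⟦⟧-cong to ι-cong; +-homo to ι-+; *-homo to ι-*; -‿homo to ι-neg; 0#-homo to ι-0; 1#-homo to ι-1)
  open import Algebra.Properties.Semiring.Exp semiring using (^-congˡ; ^-congʳ; ^-homo-*)
  open import Algebra.Properties.CommutativeSemiring.Exp commutativeSemiring using (^-distrib-*)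
  open import Algebra.Properties.CommutativeSemiring.Binomial commutativeSemiring as Binomial using (binomialExpansion)
  open import Algebra.Properties.Monoid.Sum +-monoid using (sum-cong-≋; sum⁺-syntax)
  open import Algebra.Properties.Semiring.Mult semiring using (_×_; ×-congʳ; ×-assoc-*)
  open import Relation.Binary.Reasoning.Setoid setoid

  ι-morphism : Ring.rawRing ℚ.+-*-ring SolverRing.-Raw-AlmostCommutative⟶ SolverRing.fromCommutativeRing R
  ι-morphism = record { ⟦_⟧ = ι ; +-homo = ι-+ ; *-homo = ι-* ; -‿homo = ι-neg ; 0-homo = ι-0 ; 1-homo = ι-1 }

  ι-≟ : ∀ p q → Maybe (ι p ≈ ι q)
  ι-≟ p q with p ℚ.≟ q
  ... | yes p≡q = just (ι-cong p≡q)
  ... | no  _   = nothing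

  open import Algebra.Solver.Ring (Ring.rawRing ℚ.+-*-ring) (SolverRing.fromCommutativeRing R) ι-morphism ι-≟
    using (solve; _:=_; _:+_; _:*_; :-_; _:-_)

  choose : ℕ → ℕ → Carrier
  choose n i = ι (binom (ℕ→ℚ n) i)

  ι-ℕ→ℚ : ∀ n → n × 1# ≈ ι (ℕ→ℚ n)
  ι-ℕ→ℚ zero    = sym ι-0
  ι-ℕ→ℚ (suc n) = begin
    1# + n × 1#           ≈⟨ +-cong (sym ι-1) (ι-ℕ→ℚ n) ⟩
    ι ℚ.1ℚ + ι (ℕ→ℚ n)    ≈⟨ ι-+ ℚ.1ℚ (ℕ→ℚ n) ⟨
    ι (ℚ.1ℚ ℚ.+ ℕ→ℚ n)    ≈⟨ ι-cong (ℕ→ℚ-suc n) ⟨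
    ι (ℕ→ℚ (suc n))       ∎

  Σ≤≈∑ : ∀ n (f : ℕ → Carrier) → Σ≤ n f ≈ ∑[ i ≤ n ] f (toℕ i)
  Σ≤≈∑ zero    f = sym (+-identityʳ (f 0))
  Σ≤≈∑ (suc n) f = trans (Σ≤-suc n f) (+-congˡ (Σ≤≈∑ n (λ i → f (suc i))))

  binomial-theorem : ∀ n x y → (x + y) ^ n ≈ Σ≤ n (λ i → choose n i * (x ^ i * y ^ (n ∸ i)))
  binomial-theorem n x y = begin
    (x + y) ^ n
      ≈⟨ Binomial.theorem n x y ⟩
    binomialExpansion x y n
      ≈⟨ sum-cong-≋ {suc n} (λ i → coefficient (toℕ i) (x ^ toℕ i * y ^ (n ∸ toℕ i))) ⟩
    ∑[ i ≤ n ] (choose n (toℕ i) * (x ^ toℕ i * y ^ (n ∸ toℕ i)))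
      ≈⟨ Σ≤≈∑ n _ ⟨
    Σ≤ n (λ i → choose n i * (x ^ i * y ^ (n ∸ i))) ∎
    where
    coefficient : ∀ i z → (n C i) × z ≈ choose n i * z
    coefficient i z = begin
      (n C i) × z           ≈⟨ ×-congʳ (n C i) (*-identityˡ z) ⟨
      (n C i) × (1# * z)    ≈⟨ ×-assoc-* (n C i) 1# z ⟨
      (n C i) × 1# * z      ≈⟨ *-congʳ (trans (ι-ℕ→ℚ (n C i)) (ι-cong (ℕ→ℚ-C n i))) ⟩
      choose n i * z        ∎

  ι-^ : ∀ q k → ι (q ^ℚ k) ≈ ι q ^ k
  ι-^ q zero    = ι-1
  ι-^ q (suc k) = trans (ι-* q (q ^ℚ k)) (*-congˡ (ι-^ q k))

  choose-vanish : ∀ {n i} → n < i → choose n i ≈ 0#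
  choose-vanish n<i = trans (ι-cong (binom-ℕ-vanish n<i)) ι-0

  binomial-theorem-padded : ∀ k d x y →
    Σ≤ (k ℕ.+ d) (λ i → choose k i * (x ^ i * y ^ (k ℕ.+ d ∸ i))) ≈ y ^ d * (x + y) ^ k
  binomial-theorem-padded k d x y = begin
    Σ≤ (k ℕ.+ d) f
      ≈⟨ Σ≤-vanishing-tail k d f (λ i k<i → trans (*-congʳ (choose-vanish k<i)) (zeroˡ _)) ⟩
    Σ≤ k f
      ≈⟨ Σ≤-cong≤ k split ⟩
    Σ≤ k (λ i → y ^ d * (choose k i * (x ^ i * y ^ (k ∸ i))))
      ≈⟨ *-distribˡ-Σ≤ k (y ^ d) _ ⟨
    y ^ d * Σ≤ k (λ i → choose k i * (x ^ i * y ^ (k ∸ i)))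
      ≈⟨ *-congˡ (binomial-theorem k x y) ⟨
    y ^ d * (x + y) ^ k ∎
    where
    f : ℕ → Carrier
    f i = choose k i * (x ^ i * y ^ (k ℕ.+ d ∸ i))
    split : ∀ i → i ≤ k → f i ≈ y ^ d * (choose k i * (x ^ i * y ^ (k ∸ i)))
    split i i≤k = begin
      choose k i * (x ^ i * y ^ (k ℕ.+ d ∸ i))
        ≈⟨ *-congˡ (*-congˡ (^-congʳ y (ℕ.+-∸-comm d i≤k))) ⟩
      choose k i * (x ^ i * y ^ ((k ∸ i) ℕ.+ d))
        ≈⟨ *-congˡ (*-congˡ (^-homo-* y (k ∸ i) d)) ⟩
      choose k i * (x ^ i * (y ^ (k ∸ i) * y ^ d))
        ≈⟨ solve 4 (λ c a b e → (c :* (a :* (b :* e))) := (e :* (c :* (a :* b))))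
                                                             refl (choose k i) (x ^ i) (y ^ (k ∸ i)) (y ^ d) ⟩
      y ^ d * (choose k i * (x ^ i * y ^ (k ∸ i)))      ∎

  ι-sign-^ : ∀ j x → ι (sign j) * x ^ j ≈ (- x) ^ j
  ι-sign-^ zero    x = trans (*-congʳ ι-1) (*-identityˡ 1#)
  ι-sign-^ (suc j) x = begin
    ι (ℚ.- sign j) * (x * x ^ j)
      ≈⟨ *-congʳ (ι-neg (sign j)) ⟩
    - ι (sign j) * (x * x ^ j)
      ≈⟨ solve 3 (λ σ x y → (:- σ :* (x :* y)) := (:- x :* (σ :* y))) refl (ι (sign j)) x (x ^ j) ⟩
    - x * (ι (sign j) * x ^ j)
      ≈⟨ *-congˡ (ι-sign-^ j x) ⟩
    - x * (- x) ^ j ∎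

  neg-^-even : ∀ μ x → (- x) ^ (2 ℕ.* μ) ≈ x ^ (2 ℕ.* μ)
  neg-^-even μ x = begin
    (- x) ^ (2 ℕ.* μ)                ≈⟨ ι-sign-^ (2 ℕ.* μ) x ⟨
    ι (sign (2 ℕ.* μ)) * x ^ (2 ℕ.* μ) ≈⟨ *-congʳ (trans (ι-cong (sign-even μ)) ι-1) ⟩
    1# * x ^ (2 ℕ.* μ)               ≈⟨ *-identityˡ _ ⟩
    x ^ (2 ℕ.* μ)                    ∎

  neg-^-odd : ∀ k x → (- x) ^ suc (2 ℕ.* k) ≈ - x ^ suc (2 ℕ.* k)
  neg-^-odd k x = trans (*-congˡ (neg-^-even k x)) (solve 2 (λ x y → (:- x :* y) := :- (x :* y)) refl x (x ^ (2 ℕ.* k)))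

  binomial-theorem-odd-difference : ∀ ν x y → let N = suc (2 ℕ.* ν) in
    (y - x) ^ N ≈ Σ≤ ν (λ μ → choose N (2 ℕ.* μ) * (x ^ (2 ℕ.* μ) * y ^ (N ∸ 2 ℕ.* μ)))
                - Σ≤ ν (λ k → choose N (suc (2 ℕ.* k)) * (x ^ suc (2 ℕ.* k) * y ^ (N ∸ suc (2 ℕ.* k))))
  binomial-theorem-odd-difference ν x y = begin
    (y - x) ^ N
      ≈⟨ ^-congˡ N (+-comm y (- x)) ⟩
    (- x + y) ^ N
      ≈⟨ binomial-theorem N (- x) y ⟩
    Σ≤ N (λ i → choose N i * ((- x) ^ i * y ^ (N ∸ i)))
      ≈⟨ Σ≤-even-odd ν _ ⟩
    Σ≤ ν (λ μ → term (2 ℕ.* μ)) + Σ≤ ν (λ k → term (suc (2 ℕ.* k)))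
      ≈⟨ +-cong (Σ≤-cong ν even) (trans (Σ≤-cong ν odd) (sym (Σ≤-neg ν _))) ⟩
    Σ≤ ν (λ μ → choose N (2 ℕ.* μ) * (x ^ (2 ℕ.* μ) * y ^ (N ∸ 2 ℕ.* μ)))
      - Σ≤ ν (λ k → choose N (suc (2 ℕ.* k)) * (x ^ suc (2 ℕ.* k) * y ^ (N ∸ suc (2 ℕ.* k)))) ∎
    where
    N : ℕ
    N = suc (2 ℕ.* ν)
    term : ℕ → Carrier
    term i = choose N i * ((- x) ^ i * y ^ (N ∸ i))
    even : ∀ μ → term (2 ℕ.* μ) ≈ choose N (2 ℕ.* μ) * (x ^ (2 ℕ.* μ) * y ^ (N ∸ 2 ℕ.* μ))
    even μ = *-congˡ (*-congʳ (neg-^-even μ x))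
    odd : ∀ k → term (suc (2 ℕ.* k)) ≈ - (choose N (suc (2 ℕ.* k)) * (x ^ suc (2 ℕ.* k) * y ^ (N ∸ suc (2 ℕ.* k))))
    odd k = trans (*-congˡ (*-congʳ (neg-^-odd k x)))
      (solve 3 (λ c a b → (c :* (:- a :* b)) := :- (c :* (a :* b))) refl (choose N (suc (2 ℕ.* k))) (x ^ suc (2 ℕ.* k)) _)

  ι-Σ≤ : ∀ k f → ι (Σ≤ℚ k f) ≈ Σ≤ k (λ i → ι (f i))
  ι-Σ≤ zero    f = refl
  ι-Σ≤ (suc k) f = trans (ι-+ (Σ≤ℚ k f) (f (suc k))) (+-congʳ (ι-Σ≤ k f))

  P-expansion : ∀ ν b x y → P (2 ℕ.* ν ℕ.+ 2) b x y ≈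
    Σ≤ (2 ℕ.* ν) (λ j → ι (binom (ℕ→ℚ j ℚ.+ b ℚ.- ℕ→ℚ 2) j) * x ^ j * (x + y) ^ (2 ℕ.* ν ∸ j))
  P-expansion ν b x y = reflexive (≡.cong (λ a → Σ≤ a (λ j → ι (binom (ℕ→ℚ j ℚ.+ b ℚ.- ℕ→ℚ 2) j) * x ^ j * (x + y) ^ (a ∸ j)))
    (ℕ.m+n∸n≡m (2 ℕ.* ν) 2))

  even-choose-P-sum : ∀ ν x y → let N = suc (2 ℕ.* ν) in
    Σ≤ ν (λ μ → choose N (2 ℕ.* μ) * P (2 ℕ.* ν ℕ.+ 2) ((ℤ.+ 3) ℚ./ 2 ℚ.- ℕ→ℚ μ) x y) ≈
    Σ≤ ν (λ k → choose N (suc (2 ℕ.* k)) * ((x + y) ^ (2 ℕ.* ν ∸ k) * y ^ k))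
  even-choose-P-sum ν x y = begin
    Σ≤ ν (λ μ → choose N (2 ℕ.* μ) * P (2 ℕ.* ν ℕ.+ 2) (b μ) x y)
      ≈⟨ Σ≤-cong ν expand ⟩
    Σ≤ ν (λ μ → Σ≤ T (λ j → choose N (2 ℕ.* μ) * β μ j * w j))
      ≈⟨ Σ≤-comm ν T _ ⟩
    Σ≤ T (λ j → Σ≤ ν (λ μ → choose N (2 ℕ.* μ) * β μ j * w j))
      ≈⟨ Σ≤-cong≤ T moments ⟩
    Σ≤ T (λ j → Σ≤ ν (λ k → choose N (suc (2 ℕ.* k)) * (choose k j * ((- x) ^ j * (x + y) ^ (T ∸ j)))))
      ≈⟨ Σ≤-comm T ν _ ⟩
    Σ≤ ν (λ k → Σ≤ T (λ j → choose N (suc (2 ℕ.* k)) * (choose k j * ((- x) ^ j * (x + y) ^ (T ∸ j)))))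
      ≈⟨ Σ≤-cong≤ ν binomial ⟩
    Σ≤ ν (λ k → choose N (suc (2 ℕ.* k)) * ((x + y) ^ (T ∸ k) * y ^ k)) ∎
    where
    N : ℕ
    N = suc (2 ℕ.* ν)
    T : ℕ
    T = 2 ℕ.* ν
    b : ℕ → ℚ
    b μ = (ℤ.+ 3) ℚ./ 2 ℚ.- ℕ→ℚ μ
    β : ℕ → ℕ → Carrier
    β μ j = ι (binom (ℕ→ℚ j ℚ.+ b μ ℚ.- ℕ→ℚ 2) j)
    w : ℕ → Carrier
    w j = x ^ j * (x + y) ^ (T ∸ j)

    expand : ∀ μ → choose N (2 ℕ.* μ) * P (2 ℕ.* ν ℕ.+ 2) (b μ) x y ≈ Σ≤ T (λ j → choose N (2 ℕ.* μ) * β μ j * w j)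
    expand μ = begin
      choose N (2 ℕ.* μ) * P (2 ℕ.* ν ℕ.+ 2) (b μ) x y
        ≈⟨ *-congˡ (P-expansion ν (b μ) x y) ⟩
      choose N (2 ℕ.* μ) * Σ≤ T (λ j → β μ j * x ^ j * (x + y) ^ (T ∸ j))
        ≈⟨ *-distribˡ-Σ≤ T _ _ ⟩
      Σ≤ T (λ j → choose N (2 ℕ.* μ) * (β μ j * x ^ j * (x + y) ^ (T ∸ j)))
        ≈⟨ Σ≤-cong T (λ j → solve 4 (λ c β a e → c :* (β :* a :* e) := c :* β :* (a :* e)) refl
                                     (choose N (2 ℕ.* μ)) (β μ j) (x ^ j) ((x + y) ^ (T ∸ j))) ⟩
      Σ≤ T (λ j → choose N (2 ℕ.* μ) * β μ j * w j) ∎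

    moments : ∀ j → j ≤ T →
      Σ≤ ν (λ μ → choose N (2 ℕ.* μ) * β μ j * w j) ≈
      Σ≤ ν (λ k → choose N (suc (2 ℕ.* k)) * (choose k j * ((- x) ^ j * (x + y) ^ (T ∸ j))))
    moments j j≤T = begin
      Σ≤ ν (λ μ → choose N (2 ℕ.* μ) * β μ j * w j)
        ≈⟨ *-distribʳ-Σ≤ ν (w j) _ ⟨
      Σ≤ ν (λ μ → choose N (2 ℕ.* μ) * β μ j) * w j
        ≈⟨ *-congʳ (trans (ι-Σ≤ ν _) (Σ≤-cong ν (λ μ → ι-* _ _))) ⟨
      ι (Σ≤ℚ ν (λ μ → binom (ℕ→ℚ N) (2 ℕ.* μ) ℚ.* binom (ℕ→ℚ j ℚ.+ b μ ℚ.- ℕ→ℚ 2) j)) * w j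
        ≈⟨ *-congʳ (ι-cong (even-odd-moments ν j j≤T)) ⟩
      ι (sign j ℚ.* Σ≤ℚ ν (λ k → binom (ℕ→ℚ N) (suc (2 ℕ.* k)) ℚ.* binom (ℕ→ℚ k) j)) * w j
        ≈⟨ *-congʳ (trans (ι-* _ _) (*-congˡ (trans (ι-Σ≤ ν _) (Σ≤-cong ν (λ k → ι-* _ _))))) ⟩
      ι (sign j) * Σ≤ ν (λ k → choose N (suc (2 ℕ.* k)) * choose k j) * w j
        ≈⟨ trans (*-congʳ (*-distribˡ-Σ≤ ν _ _)) (*-distribʳ-Σ≤ ν _ _) ⟩
      Σ≤ ν (λ k → ι (sign j) * (choose N (suc (2 ℕ.* k)) * choose k j) * w j)
        ≈⟨ Σ≤-cong ν (λ k → signed k) ⟩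
      Σ≤ ν (λ k → choose N (suc (2 ℕ.* k)) * (choose k j * ((- x) ^ j * (x + y) ^ (T ∸ j)))) ∎
      where
      signed : ∀ k → ι (sign j) * (choose N (suc (2 ℕ.* k)) * choose k j) * w j ≈
                     choose N (suc (2 ℕ.* k)) * (choose k j * ((- x) ^ j * (x + y) ^ (T ∸ j)))
      signed k = begin
        ι (sign j) * (choose N (suc (2 ℕ.* k)) * choose k j) * (x ^ j * (x + y) ^ (T ∸ j))
          ≈⟨ solve 5 (λ σ c d a e → σ :* (c :* d) :* (a :* e) := c :* (d :* (σ :* a :* e))) refl
               (ι (sign j)) (choose N (suc (2 ℕ.* k))) (choose k j) (x ^ j) ((x + y) ^ (T ∸ j)) ⟩
        choose N (suc (2 ℕ.* k)) * (choose k j * (ι (sign j) * x ^ j * (x + y) ^ (T ∸ j)))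
          ≈⟨ *-congˡ (*-congˡ (*-congʳ (ι-sign-^ j x))) ⟩
        choose N (suc (2 ℕ.* k)) * (choose k j * ((- x) ^ j * (x + y) ^ (T ∸ j))) ∎

    binomial : ∀ k → k ≤ ν →
      Σ≤ T (λ j → choose N (suc (2 ℕ.* k)) * (choose k j * ((- x) ^ j * (x + y) ^ (T ∸ j)))) ≈
      choose N (suc (2 ℕ.* k)) * ((x + y) ^ (T ∸ k) * y ^ k)
    binomial k k≤ν = begin
      Σ≤ T (λ j → choose N (suc (2 ℕ.* k)) * (choose k j * ((- x) ^ j * (x + y) ^ (T ∸ j))))
        ≈⟨ *-distribˡ-Σ≤ T _ _ ⟨
      choose N (suc (2 ℕ.* k)) * Σ≤ T (λ j → choose k j * ((- x) ^ j * (x + y) ^ (T ∸ j)))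
        ≈⟨ *-congˡ padded ⟩
      choose N (suc (2 ℕ.* k)) * ((x + y) ^ (T ∸ k) * (- x + (x + y)) ^ k)
        ≈⟨ *-congˡ (*-congˡ (^-congˡ k (solve 2 (λ x y → :- x :+ (x :+ y) := y) refl x y))) ⟩
      choose N (suc (2 ℕ.* k)) * ((x + y) ^ (T ∸ k) * y ^ k) ∎
      where
      padded : Σ≤ T (λ j → choose k j * ((- x) ^ j * (x + y) ^ (T ∸ j))) ≈ (x + y) ^ (T ∸ k) * (- x + (x + y)) ^ k
      padded = ≡.subst (λ n → Σ≤ n (λ j → choose k j * ((- x) ^ j * (x + y) ^ (n ∸ j))) ≈ (x + y) ^ (T ∸ k) * (- x + (x + y)) ^ k)
        (ℕ.m+[n∸m]≡n (ℕ.≤-trans k≤ν (ℕ.m≤m+n ν (ν ℕ.+ 0))))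
        (binomial-theorem-padded k (T ∸ k) (- x) (x + y))

  ^-inverse : ∀ {x x′} n → x * x′ ≈ 1# → x ^ n * x′ ^ n ≈ 1#
  ^-inverse                zero    x*x′≈1 = *-identityˡ 1#
  ^-inverse {x} {x′} (suc n) x*x′≈1 = begin
    x * x ^ n * (x′ * x′ ^ n)
      ≈⟨ solve 4 (λ a b c d → a :* b :* (c :* d) := a :* c :* (b :* d)) refl x (x ^ n) x′ (x′ ^ n) ⟩
    x * x′ * (x ^ n * x′ ^ n)
      ≈⟨ *-cong x*x′≈1 (^-inverse n x*x′≈1) ⟩
    1# * 1#
      ≈⟨ *-identityˡ 1# ⟩
    1# ∎

  *-cancelˡ-unit : ∀ {u u′ a b} → u′ * u ≈ 1# → u * a ≈ u * b → a ≈ b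
  *-cancelˡ-unit {u} {u′} {a} {b} u′*u≈1 ua≈ub = begin
    a              ≈⟨ *-identityˡ a ⟨
    1# * a         ≈⟨ *-congʳ u′*u≈1 ⟨
    u′ * u * a     ≈⟨ *-assoc u′ u a ⟩
    u′ * (u * a)   ≈⟨ *-congˡ ua≈ub ⟩
    u′ * (u * b)   ≈⟨ *-assoc u′ u b ⟨
    u′ * u * b     ≈⟨ *-congʳ u′*u≈1 ⟩
    1# * b         ≈⟨ *-identityˡ b ⟩
    b              ∎

  square-^ : ∀ x a → (x * x) ^ a ≈ x ^ (2 ℕ.* a)
  square-^ x a = begin
    (x * x) ^ a          ≈⟨ ^-distrib-* x x a ⟩
    x ^ a * x ^ a        ≈⟨ ^-homo-* x a a ⟨
    x ^ (a ℕ.+ a)        ≈⟨ ^-congʳ x (≡.cong (a ℕ.+_) (ℕ.+-identityʳ a)) ⟨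
    x ^ (2 ℕ.* a)        ∎

  module _ (ν : ℕ) (s t s⁻ t⁻ : Carrier) where
    bracket : ℕ → Carrier
    bracket μ = s⁻ ^ (2 ℕ.* ν ℕ.+ 1) * P (2 ℕ.* ν ℕ.+ 2) ((ℤ.+ 3) ℚ./ 2 ℚ.- ℕ→ℚ μ) (s * s - t * t) (t * t)
                - t ^ (2 ℕ.* μ) * t⁻ * (s * s) ^ (ν ∸ μ)

  module _ (ν : ℕ) {s t s⁻ t⁻ : Carrier} (s*s⁻≈1 : s * s⁻ ≈ 1#) (t*t⁻≈1 : t * t⁻ ≈ 1#) where
    private
      N : ℕ
      N = suc (2 ℕ.* ν)
      2ν+1≡N : 2 ℕ.* ν ℕ.+ 1 ≡ N
      2ν+1≡N = ℕ.+-comm (2 ℕ.* ν) 1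
      m n r : Carrier
      m = s * s
      n = t * t
      r = m - n
      P′ : ℕ → Carrier
      P′ μ = P (2 ℕ.* ν ℕ.+ 2) ((ℤ.+ 3) ℚ./ 2 ℚ.- ℕ→ℚ μ) r n
      C : ℕ → Carrier
      C = choose N
      power : ℕ → Carrier
      power μ = s ^ N * t ^ (2 ℕ.* μ) * m ^ (ν ∸ μ)
      even odd : ℕ → Carrier
      even μ = C (2 ℕ.* μ) * (t ^ (2 ℕ.* μ) * s ^ (N ∸ 2 ℕ.* μ))
      odd k = C (suc (2 ℕ.* k)) * (t ^ suc (2 ℕ.* k) * s ^ (N ∸ suc (2 ℕ.* k)))

    odd-monomial : ∀ k → k ≤ ν →
      t * (m ^ (2 ℕ.* ν ∸ k) * n ^ k) ≈ s ^ (2 ℕ.* ν) * (t ^ suc (2 ℕ.* k) * s ^ (N ∸ suc (2 ℕ.* k)))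
    odd-monomial k k≤ν = begin
      t * (m ^ (2 ℕ.* ν ∸ k) * n ^ k)
        ≈⟨ *-congˡ (*-cong (square-^ s (2 ℕ.* ν ∸ k)) (square-^ t k)) ⟩
      t * (s ^ (2 ℕ.* (2 ℕ.* ν ∸ k)) * t ^ (2 ℕ.* k))
        ≈⟨ *-congˡ (*-congʳ (trans (^-congʳ s (2*[2ν∸k]≡2ν+[2ν∸2k] k≤ν)) (^-homo-* s (2 ℕ.* ν) _))) ⟩
      t * (s ^ (2 ℕ.* ν) * s ^ (2 ℕ.* ν ∸ 2 ℕ.* k) * t ^ (2 ℕ.* k))
        ≈⟨ solve 4 (λ t a b c → t :* (a :* b :* c) := a :* (t :* c :* b)) refl t (s ^ (2 ℕ.* ν)) _ _ ⟩
      s ^ (2 ℕ.* ν) * (t ^ suc (2 ℕ.* k) * s ^ (N ∸ suc (2 ℕ.* k))) ∎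

    even-monomial : ∀ μ → μ ≤ ν →
      power μ ≈ s ^ (2 ℕ.* ν) * (t ^ (2 ℕ.* μ) * s ^ (N ∸ 2 ℕ.* μ))
    even-monomial μ μ≤ν = begin
      s ^ N * t ^ (2 ℕ.* μ) * m ^ (ν ∸ μ)
        ≈⟨ solve 3 (λ a b c → a :* b :* c := b :* (a :* c)) refl (s ^ N) _ _ ⟩
      t ^ (2 ℕ.* μ) * (s ^ N * m ^ (ν ∸ μ))
        ≈⟨ *-congˡ (*-congˡ (square-^ s (ν ∸ μ))) ⟩
      t ^ (2 ℕ.* μ) * (s ^ N * s ^ (2 ℕ.* (ν ∸ μ)))
        ≈⟨ *-congˡ (^-homo-* s N _) ⟨
      t ^ (2 ℕ.* μ) * s ^ (N ℕ.+ 2 ℕ.* (ν ∸ μ))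
        ≈⟨ *-congˡ (trans (^-congʳ s (1+2ν+2[ν∸μ]≡2ν+[1+2ν∸2μ] μ≤ν)) (^-homo-* s (2 ℕ.* ν) _)) ⟩
      t ^ (2 ℕ.* μ) * (s ^ (2 ℕ.* ν) * s ^ (N ∸ 2 ℕ.* μ))
        ≈⟨ solve 3 (λ a b c → a :* (b :* c) := b :* (a :* c)) refl (t ^ (2 ℕ.* μ)) _ _ ⟩
      s ^ (2 ℕ.* ν) * (t ^ (2 ℕ.* μ) * s ^ (N ∸ 2 ℕ.* μ)) ∎

    P-part : t * Σ≤ ν (λ μ → C (2 ℕ.* μ) * P′ μ) ≈ s ^ (2 ℕ.* ν) * Σ≤ ν odd
    P-part = begin
      t * Σ≤ ν (λ μ → C (2 ℕ.* μ) * P′ μ)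
        ≈⟨ *-congˡ (even-choose-P-sum ν r n) ⟩
      t * Σ≤ ν (λ k → C (suc (2 ℕ.* k)) * ((r + n) ^ (2 ℕ.* ν ∸ k) * n ^ k))
        ≈⟨ *-distribˡ-Σ≤ ν t _ ⟩
      Σ≤ ν (λ k → t * (C (suc (2 ℕ.* k)) * ((r + n) ^ (2 ℕ.* ν ∸ k) * n ^ k)))
        ≈⟨ Σ≤-cong≤ ν rescale ⟩
      Σ≤ ν (λ k → s ^ (2 ℕ.* ν) * odd k)
        ≈⟨ *-distribˡ-Σ≤ ν (s ^ (2 ℕ.* ν)) odd ⟨
      s ^ (2 ℕ.* ν) * Σ≤ ν odd ∎
      where
      r+n≈m : r + n ≈ m
      r+n≈m = solve 2 (λ m n → m :- n :+ n := m) refl m n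
      rescale : ∀ k → k ≤ ν →
        t * (C (suc (2 ℕ.* k)) * ((r + n) ^ (2 ℕ.* ν ∸ k) * n ^ k)) ≈ s ^ (2 ℕ.* ν) * odd k
      rescale k k≤ν = begin
        t * (C (suc (2 ℕ.* k)) * ((r + n) ^ (2 ℕ.* ν ∸ k) * n ^ k))
          ≈⟨ solve 3 (λ t c a → t :* (c :* a) := c :* (t :* a)) refl t (C (suc (2 ℕ.* k))) _ ⟩
        C (suc (2 ℕ.* k)) * (t * ((r + n) ^ (2 ℕ.* ν ∸ k) * n ^ k))
          ≈⟨ *-congˡ (*-congˡ (*-congʳ (^-congˡ (2 ℕ.* ν ∸ k) r+n≈m))) ⟩
        C (suc (2 ℕ.* k)) * (t * (m ^ (2 ℕ.* ν ∸ k) * n ^ k))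
          ≈⟨ *-congˡ (odd-monomial k k≤ν) ⟩
        C (suc (2 ℕ.* k)) * (s ^ (2 ℕ.* ν) * (t ^ suc (2 ℕ.* k) * s ^ (N ∸ suc (2 ℕ.* k))))
          ≈⟨ solve 3 (λ c a b → c :* (a :* b) := a :* (c :* b)) refl (C (suc (2 ℕ.* k))) (s ^ (2 ℕ.* ν)) _ ⟩
        s ^ (2 ℕ.* ν) * odd k ∎

    power-part : Σ≤ ν (λ μ → C (2 ℕ.* μ) * power μ) ≈ s ^ (2 ℕ.* ν) * Σ≤ ν even
    power-part = begin
      Σ≤ ν (λ μ → C (2 ℕ.* μ) * power μ)
        ≈⟨ Σ≤-cong≤ ν (λ μ μ≤ν → trans (*-congˡ (even-monomial μ μ≤ν))
             (solve 3 (λ c a b → c :* (a :* b) := a :* (c :* b)) refl (C (2 ℕ.* μ)) (s ^ (2 ℕ.* ν)) _)) ⟩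
      Σ≤ ν (λ μ → s ^ (2 ℕ.* ν) * even μ)
        ≈⟨ *-distribˡ-Σ≤ ν (s ^ (2 ℕ.* ν)) even ⟨
      s ^ (2 ℕ.* ν) * Σ≤ ν even ∎

    rescaled-sum :
      s ^ N * t * Σ≤ ν (λ μ → C (2 ℕ.* μ) * bracket ν s t s⁻ t⁻ μ) ≈ s ^ (2 ℕ.* ν) * - (s - t) ^ N
    rescaled-sum = begin
      s ^ N * t * Σ≤ ν (λ μ → C (2 ℕ.* μ) * bracket ν s t s⁻ t⁻ μ)
        ≈⟨ *-distribˡ-Σ≤ ν (s ^ N * t) _ ⟩
      Σ≤ ν (λ μ → s ^ N * t * (C (2 ℕ.* μ) * bracket ν s t s⁻ t⁻ μ))
        ≈⟨ Σ≤-cong ν clear-units ⟩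
      Σ≤ ν (λ μ → t * (C (2 ℕ.* μ) * P′ μ) - C (2 ℕ.* μ) * power μ)
        ≈⟨ Σ≤-distrib-sub ν _ _ ⟩
      Σ≤ ν (λ μ → t * (C (2 ℕ.* μ) * P′ μ)) - Σ≤ ν (λ μ → C (2 ℕ.* μ) * power μ)
        ≈⟨ +-cong (trans (sym (*-distribˡ-Σ≤ ν t _)) P-part) (-‿cong power-part) ⟩
      s ^ (2 ℕ.* ν) * Σ≤ ν odd - s ^ (2 ℕ.* ν) * Σ≤ ν even
        ≈⟨ solve 3 (λ a o e → a :* o :- a :* e := a :* (:- (e :- o))) refl (s ^ (2 ℕ.* ν)) _ _ ⟩
      s ^ (2 ℕ.* ν) * - (Σ≤ ν even - Σ≤ ν odd)
        ≈⟨ *-congˡ (-‿cong (binomial-theorem-odd-difference ν t s)) ⟨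
      s ^ (2 ℕ.* ν) * - (s - t) ^ N ∎
      where
      clear-units : ∀ μ → s ^ N * t * (C (2 ℕ.* μ) * bracket ν s t s⁻ t⁻ μ) ≈
        t * (C (2 ℕ.* μ) * P′ μ) - C (2 ℕ.* μ) * power μ
      clear-units μ = begin
        s ^ N * t * (C (2 ℕ.* μ) * bracket ν s t s⁻ t⁻ μ)
          ≈⟨ solve 8 (λ S t c S⁻ p τ t⁻ M → S :* t :* (c :* (S⁻ :* p :- τ :* t⁻ :* M)) :=
                        S :* S⁻ :* (t :* (c :* p)) :- t :* t⁻ :* (c :* (S :* τ :* M)))
               refl (s ^ N) t (C (2 ℕ.* μ)) (s⁻ ^ (2 ℕ.* ν ℕ.+ 1)) (P′ μ) (t ^ (2 ℕ.* μ)) t⁻ (m ^ (ν ∸ μ)) ⟩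
        s ^ N * s⁻ ^ (2 ℕ.* ν ℕ.+ 1) * (t * (C (2 ℕ.* μ) * P′ μ)) - t * t⁻ * (C (2 ℕ.* μ) * power μ)
          ≈⟨ +-cong (*-congʳ s^N*s⁻^N≈1) (-‿cong (*-congʳ t*t⁻≈1)) ⟩
        1# * (t * (C (2 ℕ.* μ) * P′ μ)) - 1# * (C (2 ℕ.* μ) * power μ)
          ≈⟨ +-cong (*-identityˡ _) (-‿cong (*-identityˡ _)) ⟩
        t * (C (2 ℕ.* μ) * P′ μ) - C (2 ℕ.* μ) * power μ ∎
        where
        s^N*s⁻^N≈1 : s ^ N * s⁻ ^ (2 ℕ.* ν ℕ.+ 1) ≈ 1#
        s^N*s⁻^N≈1 = trans (*-congˡ (^-congʳ s⁻ 2ν+1≡N)) (^-inverse N s*s⁻≈1)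

    bracket-sum : Σ≤ ν (λ μ → C (2 ℕ.* μ) * bracket ν s t s⁻ t⁻ μ) ≈ - (s⁻ * t⁻ * (s - t) ^ (2 ℕ.* ν ℕ.+ 1))
    bracket-sum = *-cancelˡ-unit {u = s ^ N * t} {u′ = s⁻ ^ N * t⁻} unit (begin
      s ^ N * t * Σ≤ ν (λ μ → C (2 ℕ.* μ) * bracket ν s t s⁻ t⁻ μ)
        ≈⟨ rescaled-sum ⟩
      s ^ (2 ℕ.* ν) * - (s - t) ^ N
        ≈⟨ trans (*-congʳ (*-identityˡ 1#)) (*-identityˡ _) ⟨
      1# * 1# * (s ^ (2 ℕ.* ν) * - (s - t) ^ N)
        ≈⟨ *-congʳ (*-cong s*s⁻≈1 t*t⁻≈1) ⟨
      s * s⁻ * (t * t⁻) * (s ^ (2 ℕ.* ν) * - (s - t) ^ N)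
        ≈⟨ solve 6 (λ s s⁻ t t⁻ a x → s :* s⁻ :* (t :* t⁻) :* (a :* (:- x)) := s :* a :* t :* (:- (s⁻ :* t⁻ :* x)))
             refl s s⁻ t t⁻ (s ^ (2 ℕ.* ν)) ((s - t) ^ N) ⟩
      s ^ N * t * - (s⁻ * t⁻ * (s - t) ^ N)
        ≈⟨ *-congˡ (-‿cong (*-congˡ (^-congʳ (s - t) 2ν+1≡N))) ⟨
      s ^ N * t * - (s⁻ * t⁻ * (s - t) ^ (2 ℕ.* ν ℕ.+ 1)) ∎)
      where
      unit : s⁻ ^ N * t⁻ * (s ^ N * t) ≈ 1#
      unit = begin
        s⁻ ^ N * t⁻ * (s ^ N * t)
          ≈⟨ solve 4 (λ a b c d → a :* b :* (c :* d) := c :* a :* (d :* b)) refl (s⁻ ^ N) t⁻ (s ^ N) t ⟩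
        s ^ N * s⁻ ^ N * (t * t⁻)
          ≈⟨ *-cong (^-inverse N s*s⁻≈1) t*t⁻≈1 ⟩
        1# * 1#
          ≈⟨ *-identityˡ 1# ⟩
        1# ∎

  LHS-factorisation : ∀ ν s t s⁻ t⁻ → LHS s t s⁻ t⁻ ν ≈
    ι (binom (ℕ→ℚ ν ℚ.- ℚ.½) ν) * Σ≤ ν (λ μ → choose (suc (2 ℕ.* ν)) (2 ℕ.* μ) * bracket ν s t s⁻ t⁻ μ)
  LHS-factorisation ν s t s⁻ t⁻ = trans (Σ≤-cong≤ ν factor) (sym (*-distribˡ-Σ≤ ν _ _))
    where
    factor : ∀ μ → μ ≤ ν →
      ι (binom (ℕ→ℚ ν ℚ.- ℚ.½) (ν ∸ μ)) * ι (binom (ℕ→ℚ ν ℚ.+ ℚ.½) μ) * bracket ν s t s⁻ t⁻ μ ≈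
      ι (binom (ℕ→ℚ ν ℚ.- ℚ.½) ν) * (choose (suc (2 ℕ.* ν)) (2 ℕ.* μ) * bracket ν s t s⁻ t⁻ μ)
    factor μ μ≤ν = begin
      ι (binom (ℕ→ℚ ν ℚ.- ℚ.½) (ν ∸ μ)) * ι (binom (ℕ→ℚ ν ℚ.+ ℚ.½) μ) * bracket ν s t s⁻ t⁻ μ
        ≈⟨ *-congʳ (ι-* _ _) ⟨
      ι (binom (ℕ→ℚ ν ℚ.- ℚ.½) (ν ∸ μ) ℚ.* binom (ℕ→ℚ ν ℚ.+ ℚ.½) μ) * bracket ν s t s⁻ t⁻ μ
        ≈⟨ *-congʳ (trans (ι-cong (binom-half-product ν μ μ≤ν)) (ι-* _ _)) ⟩
      ι (binom (ℕ→ℚ ν ℚ.- ℚ.½) ν) * choose (suc (2 ℕ.* ν)) (2 ℕ.* μ) * bracket ν s t s⁻ t⁻ μ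
        ≈⟨ *-assoc _ _ _ ⟩
      ι (binom (ℕ→ℚ ν ℚ.- ℚ.½) ν) * (choose (suc (2 ℕ.* ν)) (2 ℕ.* μ) * bracket ν s t s⁻ t⁻ μ) ∎

  central-coefficient : ∀ ν → ι ℚ.½ ^ (2 ℕ.* ν) * ι (ℕ→ℚ ((2 ℕ.* ν) C ν)) ≈ ι (binom (ℕ→ℚ ν ℚ.- ℚ.½) ν)
  central-coefficient ν = begin
    ι ℚ.½ ^ (2 ℕ.* ν) * ι (ℕ→ℚ ((2 ℕ.* ν) C ν))
      ≈⟨ *-cong (sym (ι-^ ℚ.½ (2 ℕ.* ν))) (ι-cong (ℕ→ℚ-C (2 ℕ.* ν) ν)) ⟩
    ι (ℚ.½ ^ℚ (2 ℕ.* ν)) * ι (binom (ℕ→ℚ (2 ℕ.* ν)) ν)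
      ≈⟨ ι-* _ _ ⟨
    ι (ℚ.½ ^ℚ (2 ℕ.* ν) ℚ.* binom (ℕ→ℚ (2 ℕ.* ν)) ν)
      ≈⟨ ι-cong (binom-central ν) ⟨
    ι (binom (ℕ→ℚ ν ℚ.- ℚ.½) ν) ∎

proposition6p2 : ∀ {c ℓ} (R : CommutativeRing c ℓ) (ι : ℚ → CommutativeRing.Carrier R)
    → IsRingHomomorphism (Ring.rawRing +-*-ring) (CommutativeRing.rawRing R) ι
    → (ν : ℕ) (s t s⁻ t⁻ : CommutativeRing.Carrier R)
    → CommutativeRing._≈_ R (CommutativeRing._*_ R s s⁻) (CommutativeRing.1# R)
    → CommutativeRing._≈_ R (CommutativeRing._*_ R t t⁻) (CommutativeRing.1# R)
    → CommutativeRing._≈_ R (InRing.LHS R ι s t s⁻ t⁻ ν) (InRing.RHS R ι s t s⁻ t⁻ ν)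
proposition6p2 R ι ι-hom ν s t s⁻ t⁻ s*s⁻≈1 t*t⁻≈1 = begin
  LHS s t s⁻ t⁻ ν
    ≈⟨ LHS-factorisation ν s t s⁻ t⁻ ⟩
  K * Σ≤ ν (λ μ → choose (ℕ.suc (2 ℕ.* ν)) (2 ℕ.* μ) * bracket ν s t s⁻ t⁻ μ)
    ≈⟨ *-congˡ (bracket-sum ν s*s⁻≈1 t*t⁻≈1) ⟩
  K * - (s⁻ * t⁻ * (s - t) ^ (2 ℕ.* ν ℕ.+ 1))
    ≈⟨ -‿distribʳ-* K _ ⟨
  - (K * (s⁻ * t⁻ * (s - t) ^ (2 ℕ.* ν ℕ.+ 1)))
    ≈⟨ -‿cong (trans (*-congʳ (*-congʳ (central-coefficient ν))) (*-assoc K (s⁻ * t⁻) _)) ⟨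
  RHS s t s⁻ t⁻ ν ∎
  where
  open CommutativeRing R
  open InRing R ι
  open InAlgebra R ι ι-hom
  open import Relation.Binary.Reasoning.Setoid setoid
  open import Algebra.Properties.Ring ring using (-‿distribʳ-*)
  K : Carrier
  K = ι (binom (ℕ→ℚ ν ℚ.- ℚ.½) ν)
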